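{- Let $G$ be a finite simple graph with vertex set $V=\{v_1,\dots,v_n\}$ and edge set $E$, and let $\mathbb{k}=GF(2)$. Then $N_{\mathbb{k}}(G)=1$ if and only if $G$ is covered by length $2$ paths.
   Context: Bayer's formulation of 3-colorability of $G$ over a field $\mathbb{k}$ is the polynomial system in $\mathbb{k}[x_1,\dots,x_n]$ consisting of $x_i^3-1=0$ for every vertex $v_i\in V$ and $x_i^2+x_ix_j+x_j^2=0$ for every edge $v_iv_j\in E$; when $\mathrm{char}(\mathbb{k})\neq 3$, $G$ is 3-colorable if and only if this system has a solution over the algebraic closure $\overline{\mathbb{k}}$. A Nullstellensatz certificate of infeasibility for a system $f_1=\dots=f_s=0$ is a tuple of polynomials $\alpha_1,\dots,\alpha_s\in\mathbb{k}[x_1,\dots,x_n]$ with $1=\alpha_1f_1+\dots+\alpha_sf_s$; its degree is $\max_i\deg\alpha_i$. $N_{\mathbb{k}}(G)$ denotes the minimum degree of a Nullstellensatz certificate of infeasibility for Bayer's formulation of $G$ over $\mathbb{k}$ (such certificates exist exactly when $G$ is not 3-colorable; for 3-colorable $G$, $N_{\mathbb{k}}(G)$ is undefined, i.e. not equal to any integer). A length $2$ path $v_iv_jv_k$ in $G$ consists of distinct vertices with $v_iv_j,v_jv_k\in E$; $v_j$ is its middle vertex and $v_i,v_k$ its endpoints. $G$ is \emph{covered by length 2 paths} if there exists a set $C$ of length $2$ paths in $G$ such that: (1) each edge in $E$ appears in an even number of paths in $C$; (2) the number of paths $v_iv_jv_k$ in $C$ with $j<i,k$ or $j>i,k$ is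 odd; (3) whenever $v_i,v_j\in V$ with $v_iv_j\notin E$, the number of paths in $C$ having $v_i$ and $v_j$ as endpoints is even. -}

module Defs where

open import Data.Nat using (ℕ; zero; suc; _+_; _≤_; _<_; _<ᵇ_)
import Data.Nat as ℕ
open import Data.Bool using (Bool; true; false; _∧_; _xor_; not; if_then_else_)
open import Data.Fin using (Fin; toℕ)
import Data.Fin as Fin
open import Data.Vec using (Vec; tabulate; zipWith; replicate)
import Data.Vec as Vec
import Data.Vec.Properties as VecP
open import Data.List using (List; []; _∷_; map; concatMap; concat; foldr; _++_)
open import Data.List.Base using (allFin)
open import Data.Product using (Σ; ∃; _×_; _,_)
open import Relation.Nullary using (¬_; does)
open import Relation.Binary.PropositionalEquality using (_≡_)

-- Finite simple graphs on vertex set {v_1,…,v_n} = Fin n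
-- (vertex v_{i+1} is represented by i : Fin n; the vertex order is the
-- order of Fin n).

record Graph : Set where
  field
    n     : ℕ
    adj   : Fin n → Fin n → Bool
    sym   : ∀ i j → adj i j ≡ adj j i
    irrefl : ∀ i → adj i i ≡ false
open Graph public

-- A monomial is its exponent vector; a polynomial is represented by a
-- list of monomials, the coefficient of a monomial being the parity of
-- its number of occurrences.

Mon : ℕ → Set
Mon n = Vec ℕ n

Poly : ℕ → Set
Poly n = List (Mon n)

_≟M_ : ∀ {n} (m m' : Mon n) → Bool
m ≟M m' = does (VecP.≡-dec ℕ._≟_ m m')

coeff : ∀ {n} → Poly n → Mon n → Bool
coeff p m = foldr (λ m' b → (m ≟M m') xor b) false p

_≈P_ : ∀ {n} → Poly n → Poly n → Set
p ≈P q = ∀ m → coeff p m ≡ coeff q m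

0P : ∀ {n} → Poly n
0P = []

1P : ∀ {n} → Poly n
1P {n} = replicate n 0 ∷ []

_+P_ : ∀ {n} → Poly n → Poly n → Poly n
p +P q = p ++ q

_*P_ : ∀ {n} → Poly n → Poly n → Poly n
p *P q = concatMap (λ m → map (zipWith _+_ m) q) p

mdeg : ∀ {n} → Mon n → ℕ
mdeg m = Vec.sum m

DegLe : ∀ {n} → Poly n → ℕ → Set
DegLe p d = ∀ m → coeff p m ≡ true → mdeg m ≤ d

xpow : ∀ {n} → Fin n → ℕ → Mon n
xpow i k = tabulate (λ j → if does (i Fin.≟ j) then k else 0)

xx : ∀ {n} → Fin n → Fin n → Mon n
xx i j = zipWith _+_ (xpow i 1) (xpow j 1)

-- Bayer's formulation over GF(2) (where -1 = 1):
--   vertex polynomial  x_i^3 - 1 = x_i^3 + 1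
--   edge polynomial    x_i^2 + x_i x_j + x_j^2   for each edge v_i v_j

vertexPoly : ∀ {n} → Fin n → Poly n
vertexPoly i = xpow i 3 ∷ replicate _ 0 ∷ []

edgePoly : ∀ {n} → Fin n → Fin n → Poly n
edgePoly i j = xpow i 2 ∷ xx i j ∷ xpow j 2 ∷ []

ΣP : ∀ {n} {A : Set} → List A → (A → Poly n) → Poly n
ΣP xs f = concatMap f xs

pairs : (n : ℕ) → List (Fin n × Fin n)
pairs n = concatMap (λ i → map (λ j → (i , j)) (allFin n)) (allFin n)

triples : (n : ℕ) → List (Fin n × Fin n × Fin n)
triples n = concatMap (λ i → concatMap (λ j → map (λ k → (i , j , k)) (allFin n)) (allFin n)) (allFin n)

isEdgeIdx : (G : Graph) → Fin (n G) → Fin (n G) → Bool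
isEdgeIdx G i j = (toℕ i <ᵇ toℕ j) ∧ adj G i j

combo : (G : Graph) → (Fin (n G) → Poly (n G)) → (Fin (n G) → Fin (n G) → Poly (n G)) → Poly (n G)
combo G αV αE =
  ΣP (allFin (n G)) (λ i → αV i *P vertexPoly i)
  +P ΣP (pairs (n G)) (λ { (i , j) → if isEdgeIdx G i j then αE i j *P edgePoly i j else 0P })

-- A Nullstellensatz certificate of infeasibility of degree ≤ d over GF(2)
-- (only the αE i j with (i , j) an edge index are coefficients; the others are ignored)
HasCert : Graph → ℕ → Set
HasCert G d =
  Σ (Fin (n G) → Poly (n G)) λ αV →
  Σ (Fin (n G) → Fin (n G) → Poly (n G)) λ αE →
    (∀ i → DegLe (αV i) d)
  × (∀ i j → isEdgeIdx G i j ≡ true → DegLe (αE i j) d)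
  × (combo G αV αE ≈P 1P)

N≡ : Graph → ℕ → Set
N≡ G d = HasCert G d × (∀ d' → d' < d → ¬ HasCert G d')

-- A length 2 path v_i v_j v_k (as an unordered path, v_i v_j v_k = v_k v_j v_i)
-- is represented uniquely by the triple (i , j , k) with i < k and
-- v_i v_j, v_j v_k ∈ E (distinctness of i,j,k then follows).

isPath : (G : Graph) → Fin (n G) × Fin (n G) × Fin (n G) → Bool
isPath G (i , j , k) = (toℕ i <ᵇ toℕ k) ∧ adj G i j ∧ adj G j k

parity : ∀ {n} → (Fin n × Fin n × Fin n → Bool) → Bool
parity {n} P = foldr (λ t b → P t xor b) false (triples n)

sameEdge : ∀ {n} → Fin n → Fin n → Fin n → Fin n → Bool
sameEdge i j a b =
  (does (i Fin.≟ a) ∧ does (j Fin.≟ b)) xor (does (i Fin.≟ b) ∧ does (j Fin.≟ a))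

CoveredByLength2Paths : Graph → Set
CoveredByLength2Paths G =
  Σ (Fin (n G) × Fin (n G) × Fin (n G) → Bool) λ C →
  let inC = λ t → isPath G t ∧ C t in
    -- (1) each edge lies in an even number of paths of C
    (∀ a b → adj G a b ≡ true →
      parity (λ { (i , j , k) → inC (i , j , k) ∧ (sameEdge i j a b xor sameEdge j k a b) }) ≡ false)
    -- (2) odd number of paths whose middle vertex is smallest or largest
  × (parity (λ { (i , j , k) → inC (i , j , k) ∧
        (((toℕ j <ᵇ toℕ i) ∧ (toℕ j <ᵇ toℕ k)) xor ((toℕ i <ᵇ toℕ j) ∧ (toℕ k <ᵇ toℕ j))) }) ≡ true)
    -- (3) non-adjacent a,b are the endpoints of an even number of paths of C
  × (∀ a b → adj G a b ≡ false →
      parity (λ { (i , j , k) → inC (i , j , k) ∧ sameEdge i k a b }) ≡ false)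

-- Comparing the coefficients of
-- 1, x_a³, x_a x_b² and x_a x_b x_c turns 1 = Σ α f into a linear system for the coefficients
-- B(ij, k) of x_k in the multipliers of the edge polynomials (the x_a³ equations only fix the
-- constants of the vertex multipliers), and a certificate of degree zero is impossible because
-- then all B(ij, k) vanish.  Solutions of this system and covers by length 2 paths determine each
-- other: a path i-j-k is chosen with weight B(ik, j) if v_i v_k is an edge and B(ij, k) otherwise;
-- conversely B(ij, k) counts the chosen paths formed by v_i v_j and an edge to v_k, corrected at
-- the ends of v_i v_j.  The equations for x_a x_b² become conditions (1) and (3), and those for
-- x_a x_b x_c hold automatically or make the paths inside triangles cancel.  As the paths across
-- non-edges cancel by (3), the number of all chosen paths is even, so condition (2) says that an
-- odd number of them have their middle vertex between their ends: the equation for the constant term.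

module Submission where

open import Defs hiding (sym)
open import Algebra.Bundles using (CommutativeRing)
import Algebra.Properties.CommutativeSemigroup as CommutativeSemigroupProperties
open import Data.Bool using (Bool; true; false; _∧_; _xor_; not; if_then_else_)
import Data.Bool.Properties as BP
open import Data.Empty using (⊥-elim)
open import Data.Fin as Fin using (Fin; zero; suc; toℕ)
import Data.Fin.Properties as FinP
open import Data.List as List using (List; []; _∷_; _++_; concatMap; length; allFin)
import Data.List.Properties as ListP
open import Data.Nat as ℕ using (ℕ; zero; suc; _+_; _≤_; _<ᵇ_; z≤n; s≤s)
import Data.Nat.Properties as ℕP
open import Data.Product using (_×_; _,_; ∃-syntax; proj₁; proj₂)
open import Data.Sum using (_⊎_; inj₁; inj₂)
open import Data.Vec as Vec using (_∷_; lookup; zipWith; replicate)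
import Data.Vec.Properties as VecP
open import Data.Vec.Relation.Binary.Pointwise.Inductive
  using (Pointwise-≡⇒≡; zipWith-comm; zipWith-assoc; zipWith-identityˡ)
open import Function.Base using (_∘_)
open import Function.Bundles using (_⇔_; mk⇔; Equivalence)
open import Relation.Binary.PropositionalEquality
open import Relation.Nullary using (¬_; does; yes; no)
open import Relation.Nullary.Decidable using (dec-true; dec-false)

open import Algebra.Properties.Semiring.Sum (CommutativeRing.semiring BP.xor-∧-commutativeRing)
  using (sum; sum-cong-≗; ∑-distrib-+; ∑-comm; *-distribˡ-sum; *-distribʳ-sum; sum-replicate-zero)
open import Algebra.Solver.CommutativeMonoid (CommutativeRing.+-commutativeMonoid BP.xor-∧-commutativeRing)
  using (solve; _⊕_; _⊜_; id)

xor≡false⇒≡ : ∀ {a b} → a xor b ≡ false → a ≡ b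
xor≡false⇒≡ {false} eq = sym eq
xor≡false⇒≡ {true} {false} ()
xor≡false⇒≡ {true} {true} _ = refl

xor≡true⇒≡not : ∀ {a b} → a xor b ≡ true → b ≡ not a
xor≡true⇒≡not {false} eq = eq
xor≡true⇒≡not {true} {false} _ = refl
xor≡true⇒≡not {true} {true} ()

∧-left-comm : ∀ a b c → a ∧ (b ∧ c) ≡ b ∧ (a ∧ c)
∧-left-comm a b c = trans (sym (BP.∧-assoc a b c)) (trans (cong (_∧ c) (BP.∧-comm a b)) (BP.∧-assoc b a c))

∧-guard : ∀ x {y z} → (x ≡ true → y ≡ z) → x ∧ y ≡ x ∧ z
∧-guard false _ = refl
∧-guard true h = h refl

∧-true⇒ : ∀ {x y} → x ∧ y ≡ true → x ≡ true × y ≡ true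
∧-true⇒ {true} {true} _ = refl , refl

sum-zero : ∀ {n} {f : Fin n → Bool} → (∀ i → f i ≡ false) → sum f ≡ false
sum-zero {n} h = trans (sum-cong-≗ h) (sum-replicate-zero n)

δ : ∀ {n} → Fin n → Fin n → Bool
δ i j = does (i Fin.≟ j)

δ-refl : ∀ {n} (i : Fin n) → δ i i ≡ true
δ-refl i = dec-true (i Fin.≟ i) refl

δ-≢ : ∀ {n} {i j : Fin n} → i ≢ j → δ i j ≡ false
δ-≢ {i = i} {j} = dec-false (i Fin.≟ j)

δ-sym : ∀ {n} (i j : Fin n) → δ i j ≡ δ j i
δ-sym i j with i Fin.≟ j
... | yes refl = sym (δ-refl i)
... | no i≢j = sym (δ-≢ (i≢j ∘ sym))

δ-refl-∧ : ∀ {n} (i : Fin n) (x : Bool) → δ i i ∧ x ≡ x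
δ-refl-∧ i x = cong (_∧ x) (δ-refl i)

δ-≢-∧ : ∀ {n} {i j : Fin n} → i ≢ j → (x : Bool) → δ i j ∧ x ≡ false
δ-≢-∧ i≢j x = cong (_∧ x) (δ-≢ i≢j)

∑-δ : ∀ {n} (a : Fin n) (f : Fin n → Bool) → sum (λ i → δ i a ∧ f i) ≡ f a
∑-δ {suc n} zero f = trans (cong (f zero xor_) (sum-zero {n} λ _ → refl)) (BP.xor-identityʳ (f zero))
∑-δ         (suc a) f = ∑-δ a (f ∘ suc)

∑-diag : ∀ {n} (A : Fin n → Bool) (y : Fin n) (F : Bool) → sum (λ z → A z ∧ (δ z y ∧ F)) ≡ A y ∧ F
∑-diag A y F = trans (sum-cong-≗ λ z → ∧-left-comm (A z) (δ z y) F) (∑-δ y (λ z → A z ∧ F))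

sum³ : ∀ {n} → (Fin n → Fin n → Fin n → Bool) → Bool
sum³ f = sum λ i → sum λ j → sum λ k → f i j k

module _ {n : ℕ} where

  sum³-cong : {f g : Fin n → Fin n → Fin n → Bool} → (∀ i j k → f i j k ≡ g i j k) → sum³ f ≡ sum³ g
  sum³-cong h = sum-cong-≗ λ i → sum-cong-≗ λ j → sum-cong-≗ (h i j)

  sum³-xor : (f g : Fin n → Fin n → Fin n → Bool) →
             sum³ (λ i j k → f i j k xor g i j k) ≡ sum³ f xor sum³ g
  sum³-xor f g = trans (sum-cong-≗ λ i → trans (sum-cong-≗ λ j → ∑-distrib-+ (f i j) (g i j))
                                               (∑-distrib-+ (λ j → sum (f i j)) (λ j → sum (g i j))))
                       (∑-distrib-+ (λ i → sum λ j → sum (f i j)) (λ i → sum λ j → sum (g i j)))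

  sum³-zero : {f : Fin n → Fin n → Fin n → Bool} → (∀ i j k → f i j k ≡ false) → sum³ f ≡ false
  sum³-zero h = sum-zero λ i → sum-zero λ j → sum-zero (h i j)

  ∑²-δ² : (F : Fin n → Fin n → Bool) (p q : Fin n) → sum (λ i → sum λ j → F i j ∧ (δ i p ∧ δ j q)) ≡ F p q
  ∑²-δ² F p q = begin
    sum (λ i → sum λ j → F i j ∧ (δ i p ∧ δ j q))
      ≡⟨ sum-cong-≗ (λ i → sum-cong-≗ λ j → trans (BP.∧-comm (F i j) _) (BP.∧-assoc (δ i p) (δ j q) (F i j))) ⟩
    sum (λ i → sum λ j → δ i p ∧ (δ j q ∧ F i j))
      ≡⟨ sum-cong-≗ (λ i → *-distribˡ-sum (δ i p) (λ j → δ j q ∧ F i j)) ⟨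
    sum (λ i → δ i p ∧ sum λ j → δ j q ∧ F i j)
      ≡⟨ ∑-δ p (λ i → sum λ j → δ j q ∧ F i j) ⟩
    sum (λ j → δ j q ∧ F p j)
      ≡⟨ ∑-δ q (F p) ⟩
    F p q ∎
    where open ≡-Reasoning

  module _ (F : Fin n → Fin n → Fin n → Bool) (p q : Fin n) where

    ∑³-δ₁₂ : sum³ (λ i j k → F i j k ∧ (δ i p ∧ δ j q)) ≡ sum (F p q)
    ∑³-δ₁₂ = trans (sum-cong-≗ λ i → sum-cong-≗ λ j → sym (*-distribʳ-sum (δ i p ∧ δ j q) (F i j)))
                   (∑²-δ² (λ i j → sum (F i j)) p q)

    ∑³-δ₂₃ : sum³ (λ i j k → F i j k ∧ (δ j p ∧ δ k q)) ≡ sum (λ i → F i p q)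
    ∑³-δ₂₃ = sum-cong-≗ λ i → ∑²-δ² (F i) p q

    ∑³-δ₁₃ : sum³ (λ i j k → F i j k ∧ (δ i p ∧ δ k q)) ≡ sum (λ j → F p j q)
    ∑³-δ₁₃ = trans (sum-cong-≗ λ i → trans (∑-comm (λ j k → F i j k ∧ (δ i p ∧ δ k q)))
                                          (sum-cong-≗ λ k → sym (*-distribʳ-sum (δ i p ∧ δ k q) (λ j → F i j k))))
                   (∑²-δ² (λ i k → sum λ j → F i j k) p q)

  sum³-reverse : (F : Fin n → Fin n → Fin n → Bool) → sum³ (λ i j k → F k j i) ≡ sum³ F
  sum³-reverse F = begin
    sum (λ i → sum λ j → sum λ k → F k j i) ≡⟨ sum-cong-≗ (λ i → ∑-comm (λ j k → F k j i)) ⟩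
    sum (λ i → sum λ k → sum λ j → F k j i) ≡⟨ ∑-comm (λ i k → sum λ j → F k j i) ⟩
    sum (λ k → sum λ i → sum λ j → F k j i) ≡⟨ sum-cong-≗ (λ k → ∑-comm (λ i j → F k j i)) ⟩
    sum³ F ∎
    where open ≡-Reasoning

  sum³-swap₂₃ : (F : Fin n → Fin n → Fin n → Bool) → sum³ (λ i j k → F i k j) ≡ sum³ F
  sum³-swap₂₃ F = sum-cong-≗ λ i → ∑-comm (λ j k → F i k j)

  sum³-rotate : (F : Fin n → Fin n → Fin n → Bool) → sum³ (λ i j k → F j k i) ≡ sum³ F
  sum³-rotate F = trans (∑-comm (λ i j → sum λ k → F j k i)) (sum-cong-≗ λ j → ∑-comm (λ i k → F j k i))

infixl 30 _*M_
_*M_ : ∀ {n} → Mon n → Mon n → Mon n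
u *M v = zipWith _+_ u v

0M : ∀ {n} → Mon n
0M {n} = replicate n 0

e : ∀ {n} → Fin n → Mon n
e i = xpow i 1

cubic : ∀ {n} → Fin n → Fin n → Fin n → Mon n
cubic a b c = e a *M (e b *M e c)

module _ {n : ℕ} where

  *M-comm : (u v : Mon n) → u *M v ≡ v *M u
  *M-comm u v = Pointwise-≡⇒≡ (zipWith-comm ℕP.+-comm u v)

  *M-assoc : (u v w : Mon n) → u *M v *M w ≡ u *M (v *M w)
  *M-assoc u v w = Pointwise-≡⇒≡ (zipWith-assoc ℕP.+-assoc u v w)

  *M-identityˡ : (u : Mon n) → 0M *M u ≡ u
  *M-identityˡ u = Pointwise-≡⇒≡ (zipWith-identityˡ ℕP.+-identityˡ u)

  *M-identityʳ : (u : Mon n) → u *M 0M ≡ u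
  *M-identityʳ u = trans (*M-comm u 0M) (*M-identityˡ u)

  cubic-swap₁₂ : (a b c : Fin n) → cubic a b c ≡ cubic b a c
  cubic-swap₁₂ a b c = begin
    e a *M (e b *M e c)   ≡⟨ *M-assoc (e a) (e b) (e c) ⟨
    e a *M e b *M e c     ≡⟨ cong (_*M e c) (*M-comm (e a) (e b)) ⟩
    e b *M e a *M e c     ≡⟨ *M-assoc (e b) (e a) (e c) ⟩
    e b *M (e a *M e c)   ∎
    where open ≡-Reasoning

  cubic-swap₂₃ : (a b c : Fin n) → cubic a b c ≡ cubic a c b
  cubic-swap₂₃ a b c = cong (e a *M_) (*M-comm (e b) (e c))

  lookup-*M : (u v : Mon n) (t : Fin n) → lookup (u *M v) t ≡ lookup u t + lookup v t
  lookup-*M u v t = VecP.lookup-zipWith _+_ t u v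

  lookup-e : (a t : Fin n) → lookup (e a) t ≡ (if δ a t then 1 else 0)
  lookup-e a t = VecP.lookup∘tabulate _ t

  lookup-e-self : (a : Fin n) → lookup (e a) a ≡ 1
  lookup-e-self a = trans (lookup-e a a) (cong (λ b → if b then 1 else 0) (δ-refl a))

  lookup-e-≢ : {a t : Fin n} → a ≢ t → lookup (e a) t ≡ 0
  lookup-e-≢ {a} {t} a≢t = trans (lookup-e a t) (cong (λ b → if b then 1 else 0) (δ-≢ a≢t))

  lookup-ext : {u v : Mon n} → (∀ t → lookup u t ≡ lookup v t) → u ≡ v
  lookup-ext {u} {v} h = begin
    u                      ≡⟨ VecP.tabulate∘lookup u ⟨
    Vec.tabulate (lookup u) ≡⟨ VecP.tabulate-cong h ⟩
    Vec.tabulate (lookup v) ≡⟨ VecP.tabulate∘lookup v ⟩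
    v                      ∎
    where open ≡-Reasoning

  *M-cancelˡ : (a u v : Mon n) → a *M u ≡ a *M v → u ≡ v
  *M-cancelˡ a u v eq = lookup-ext λ t → ℕP.+-cancelˡ-≡ (lookup a t) _ _
    (trans (sym (lookup-*M a u t)) (trans (cong (λ w → lookup w t) eq) (lookup-*M a v t)))

mdeg-*M : ∀ {n} (u v : Mon n) → mdeg (u *M v) ≡ mdeg u + mdeg v
mdeg-*M Vec.[] Vec.[] = refl
mdeg-*M (x ∷ u) (y ∷ v) = trans (cong (x + y +_) (mdeg-*M u v)) (interchange x y (mdeg u) (mdeg v))
  where open CommutativeSemigroupProperties ℕP.+-commutativeSemigroup using (interchange)

mdeg-0M : ∀ {n} → mdeg (0M {n}) ≡ 0
mdeg-0M {zero} = refl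
mdeg-0M {suc n} = mdeg-0M {n}

e-zero : ∀ {n} → e {suc n} zero ≡ 1 ∷ 0M
e-zero = lookup-ext λ where
  zero → refl
  (suc t) → trans (VecP.lookup∘tabulate _ t) (sym (VecP.lookup-replicate t 0))

mdeg-e : ∀ {n} (i : Fin n) → mdeg (e i) ≡ 1
mdeg-e {suc n} zero = trans (cong mdeg (e-zero {n})) (cong suc (mdeg-0M {n}))
mdeg-e (suc i) = mdeg-e i

module _ {n : ℕ} where

  xpow-zero : (i : Fin n) → xpow i 0 ≡ 0M
  xpow-zero i = lookup-ext λ t → trans (VecP.lookup∘tabulate _ t)
    (trans (if-same (δ i t)) (sym (VecP.lookup-replicate t 0)))
    where
    if-same : ∀ b → (if b then 0 else 0) ≡ 0
    if-same true = refl
    if-same false = refl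

  xpow-suc : (i : Fin n) (k : ℕ) → xpow i (suc k) ≡ e i *M xpow i k
  xpow-suc i k = lookup-ext λ t → trans (VecP.lookup∘tabulate _ t)
    (trans (if-suc (δ i t)) (sym (trans (lookup-*M (e i) (xpow i k) t)
      (cong₂ _+_ (lookup-e i t) (VecP.lookup∘tabulate _ t)))))
    where
    if-suc : ∀ b → (if b then suc k else 0) ≡ (if b then 1 else 0) + (if b then k else 0)
    if-suc true = refl
    if-suc false = refl

  xpow-2 : (i : Fin n) → xpow i 2 ≡ e i *M e i
  xpow-2 i = trans (xpow-suc i 1) (cong (e i *M_) (trans (xpow-suc i 0)
    (trans (cong (e i *M_) (xpow-zero i)) (*M-identityʳ (e i)))))

  xpow-3 : (i : Fin n) → xpow i 3 ≡ cubic i i i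
  xpow-3 i = trans (xpow-suc i 2) (cong (e i *M_) (xpow-2 i))

  mdeg-cubic : (a b c : Fin n) → mdeg (cubic a b c) ≡ 3
  mdeg-cubic a b c = trans (mdeg-*M (e a) (e b *M e c))
    (cong₂ _+_ (mdeg-e a) (trans (mdeg-*M (e b) (e c)) (cong₂ _+_ (mdeg-e b) (mdeg-e c))))

  lookup-e*M-self : (x : Fin n) (v : Mon n) → lookup (e x *M v) x ≡ suc (lookup v x)
  lookup-e*M-self x v = trans (lookup-*M (e x) v x) (cong (_+ lookup v x) (lookup-e-self x))

  ≟M-refl : (m : Mon n) → (m ≟M m) ≡ true
  ≟M-refl m = dec-true (VecP.≡-dec ℕ._≟_ m m) refl

  ≟M-≢ : {m w : Mon n} → m ≢ w → (m ≟M w) ≡ false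
  ≟M-≢ {m} {w} = dec-false (VecP.≡-dec ℕ._≟_ m w)

  ≟M-deg : {m w : Mon n} → mdeg m ≢ mdeg w → (m ≟M w) ≡ false
  ≟M-deg {m} {w} p = ≟M-≢ {m} {w} (p ∘ cong mdeg)

  ≟M-degrees : (m w : Mon n) {d₁ d₂ : ℕ} → mdeg m ≡ d₁ → mdeg w ≡ d₂ → d₁ ≢ d₂ → (m ≟M w) ≡ false
  ≟M-degrees m w deg-m deg-w d₁≢d₂ = ≟M-deg {m = m} {w = w} λ eq → d₁≢d₂ (trans (sym deg-m) (trans eq deg-w))

  ≟M-cancelˡ : (a u v : Mon n) → (a *M u ≟M a *M v) ≡ (u ≟M v)
  ≟M-cancelˡ a u v with VecP.≡-dec ℕ._≟_ u v
  ... | yes refl = ≟M-refl (a *M u)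
  ... | no u≢v = ≟M-≢ {a *M u} {a *M v} (u≢v ∘ *M-cancelˡ a u v)

  ≟M-absent : (m w : Mon n) (x : Fin n) {k : ℕ} → lookup m x ≡ 0 → lookup w x ≡ suc k → (m ≟M w) ≡ false
  ≟M-absent m w x m0 w1 = ≟M-≢ {m} {w} λ eq → ℕP.0≢1+n (trans (sym m0) (trans (cong (λ v → lookup v x) eq) w1))

  ≟M-e : (a z : Fin n) → (e a ≟M e z) ≡ δ z a
  ≟M-e a z with z Fin.≟ a
  ... | yes refl = ≟M-refl (e z)
  ... | no z≢a = ≟M-absent (e a) (e z) z (lookup-e-≢ (z≢a ∘ sym)) (lookup-e-self z)

  lookup-pair-absent : {b c x : Fin n} → x ≢ b → x ≢ c → lookup (e b *M e c) x ≡ 0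
  lookup-pair-absent {b} {c} {x} x≢b x≢c =
    trans (lookup-*M (e b) (e c) x) (cong₂ _+_ (lookup-e-≢ (x≢b ∘ sym)) (lookup-e-≢ (x≢c ∘ sym)))

  ≟M-square : (b y z : Fin n) → (e b *M e b ≟M e y *M e z) ≡ δ y b ∧ δ z b
  ≟M-square b y z with y Fin.≟ b
  ... | yes refl = trans (≟M-cancelˡ (e y) (e y) (e z)) (≟M-e y z)
  ... | no y≢b = ≟M-absent (e b *M e b) (e y *M e z) y (lookup-pair-absent y≢b y≢b) (lookup-e*M-self y (e z))

  ≟M-pair : {b c : Fin n} → b ≢ c → (y z : Fin n) →
           (e b *M e c ≟M e y *M e z) ≡ (δ y b ∧ δ z c) xor (δ y c ∧ δ z b)
  ≟M-pair {b} {c} b≢c y z with y Fin.≟ b | y Fin.≟ c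
  ... | yes refl | yes refl = ⊥-elim (b≢c refl)
  ... | yes refl | no _ = trans (≟M-cancelˡ (e y) (e c) (e z))
                                (trans (≟M-e c z) (sym (BP.xor-identityʳ (δ z c))))
  ... | no _ | yes refl = trans (cong (_≟M e y *M e z) (*M-comm (e b) (e y))) (trans (≟M-cancelˡ (e y) (e b) (e z)) (≟M-e b z))
  ... | no y≢b | no y≢c = ≟M-absent (e b *M e c) (e y *M e z) y (lookup-pair-absent y≢b y≢c) (lookup-e*M-self y (e z))

  lookup-cubic-absent : {a b c x : Fin n} → x ≢ a → x ≢ b → x ≢ c → lookup (cubic a b c) x ≡ 0
  lookup-cubic-absent {a} {b} {c} {x} x≢a x≢b x≢c =
    trans (lookup-*M (e a) (e b *M e c) x) (cong₂ _+_ (lookup-e-≢ (x≢a ∘ sym)) (lookup-pair-absent x≢b x≢c))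

mdeg≡0⇒≡0M : ∀ {n} (m : Mon n) → mdeg m ≡ 0 → m ≡ 0M
mdeg≡0⇒≡0M Vec.[] _ = refl
mdeg≡0⇒≡0M (x ∷ m) h = cong₂ _∷_ (ℕP.m+n≡0⇒m≡0 x h) (mdeg≡0⇒≡0M m (ℕP.m+n≡0⇒n≡0 x h))

mdeg≡suc⇒factor : ∀ {n d} (m : Mon n) → mdeg m ≡ suc d → ∃[ x ] ∃[ w ] m ≡ e x *M w × mdeg w ≡ d
mdeg≡suc⇒factor (zero ∷ m) h with mdeg≡suc⇒factor m h
... | x , w , refl , deg-w = suc x , 0 ∷ w , refl , deg-w
mdeg≡suc⇒factor {suc n} (suc k ∷ m) h =
  zero , k ∷ m , sym (trans (cong (_*M (k ∷ m)) (e-zero {n})) (cong (suc k ∷_) (*M-identityˡ m))) ,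
  ℕP.suc-injective h

mdeg≡1⇒≡e : ∀ {n} (m : Mon n) → mdeg m ≡ 1 → ∃[ x ] m ≡ e x
mdeg≡1⇒≡e m h with mdeg≡suc⇒factor m h
... | x , w , refl , deg-w rewrite mdeg≡0⇒≡0M w deg-w = x , *M-identityʳ (e x)

mdeg≡3⇒cubic : ∀ {n} (m : Mon n) → mdeg m ≡ 3 → ∃[ a ] ∃[ b ] ∃[ c ] m ≡ cubic a b c
mdeg≡3⇒cubic m h with mdeg≡suc⇒factor m h
... | a , w , refl , deg-w with mdeg≡suc⇒factor w deg-w
...   | b , v , refl , deg-v with mdeg≡1⇒≡e v deg-v
...     | c , refl = a , b , c , refl

δ³ : ∀ {n} → Fin n → Fin n → Fin n → Fin n → Fin n → Fin n → Bool
δ³ x y z p q r = δ x p ∧ (δ y q ∧ δ z r)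

module _ {n : ℕ} where

  ≟M-cubic-aaa : (a x y z : Fin n) → (cubic a a a ≟M cubic x y z) ≡ δ³ x y z a a a
  ≟M-cubic-aaa a x y z with x Fin.≟ a
  ... | yes refl = trans (≟M-cancelˡ (e x) (e x *M e x) (e y *M e z)) (≟M-square x y z)
  ... | no x≢a = ≟M-absent (cubic a a a) (cubic x y z) x
                   (lookup-cubic-absent x≢a x≢a x≢a) (lookup-e*M-self x (e y *M e z))

  ≟M-cubic-abb : {a b : Fin n} → a ≢ b → (x y z : Fin n) →
                 (cubic a b b ≟M cubic x y z) ≡ δ³ x y z a b b xor (δ³ x y z b a b xor δ³ x y z b b a)
  ≟M-cubic-abb {a} {b} a≢b x y z with x Fin.≟ a | x Fin.≟ b
  ... | yes refl | yes refl = ⊥-elim (a≢b refl)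
  ... | yes refl | no _ = trans (≟M-cancelˡ (e x) (e b *M e b) (e y *M e z))
                                (trans (≟M-square b y z) (sym (BP.xor-identityʳ _)))
  ... | no _ | yes refl = trans (cong (_≟M cubic x y z) (cubic-swap₁₂ a x x))
                                (trans (≟M-cancelˡ (e x) (e a *M e x) (e y *M e z)) (≟M-pair a≢b y z))
  ... | no x≢a | no x≢b = ≟M-absent (cubic a b b) (cubic x y z) x
                            (lookup-cubic-absent x≢a x≢b x≢b) (lookup-e*M-self x (e y *M e z))

  ≟M-cubic-abc : {a b c : Fin n} → a ≢ b → a ≢ c → b ≢ c → (x y z : Fin n) →
              (cubic a b c ≟M cubic x y z) ≡
                δ³ x y z a b c xor (δ³ x y z a c b xor (δ³ x y z b a c xor
                (δ³ x y z b c a xor (δ³ x y z c a b xor δ³ x y z c b a))))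
  ≟M-cubic-abc {a} {b} {c} a≢b a≢c b≢c x y z with x Fin.≟ a | x Fin.≟ b | x Fin.≟ c
  ... | yes refl | yes refl | _ = ⊥-elim (a≢b refl)
  ... | yes refl | _ | yes refl = ⊥-elim (a≢c refl)
  ... | _ | yes refl | yes refl = ⊥-elim (b≢c refl)
  ... | yes refl | no _ | no _ =
    trans (≟M-cancelˡ (e x) (e b *M e c) (e y *M e z))
          (trans (≟M-pair b≢c y z) (cong ((δ y b ∧ δ z c) xor_) (sym (BP.xor-identityʳ _))))
  ... | no _ | yes refl | no _ =
    trans (cong (_≟M cubic x y z) (cubic-swap₁₂ a x c))
          (trans (≟M-cancelˡ (e x) (e a *M e c) (e y *M e z))
                 (trans (≟M-pair a≢c y z) (cong ((δ y a ∧ δ z c) xor_) (sym (BP.xor-identityʳ _)))))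
  ... | no _ | no _ | yes refl =
    trans (cong (_≟M cubic x y z) (trans (cubic-swap₂₃ a b x) (cubic-swap₁₂ a x b)))
          (trans (≟M-cancelˡ (e x) (e a *M e b) (e y *M e z)) (≟M-pair a≢b y z))
  ... | no x≢a | no x≢b | no x≢c = ≟M-absent (cubic a b c) (cubic x y z) x
                                     (lookup-cubic-absent x≢a x≢b x≢c) (lookup-e*M-self x (e y *M e z))

listSum : ∀ {A : Set} → (A → Bool) → List A → Bool
listSum h = List.foldr (λ x b → h x xor b) false

module _ {A : Set} (h : A → Bool) where

  listSum-++ : (xs ys : List A) → listSum h (xs ++ ys) ≡ listSum h xs xor listSum h ys
  listSum-++ [] ys = refl
  listSum-++ (x ∷ xs) ys = trans (cong (h x xor_) (listSum-++ xs ys)) (sym (BP.xor-assoc (h x) _ _))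

  listSum-cancel-pair : (u : A) (xs ys : List A) → listSum h (u ∷ xs ++ u ∷ ys) ≡ listSum h (xs ++ ys)
  listSum-cancel-pair u xs ys = begin
    h u xor listSum h (xs ++ u ∷ ys)                ≡⟨ cong (h u xor_) (listSum-++ xs (u ∷ ys)) ⟩
    h u xor (listSum h xs xor (h u xor listSum h ys)) ≡⟨ cancel (h u) (listSum h xs) (listSum h ys) ⟩
    listSum h xs xor listSum h ys                    ≡⟨ listSum-++ xs ys ⟨
    listSum h (xs ++ ys)                             ∎
    where
    open ≡-Reasoning
    cancel : ∀ a b c → a xor (b xor (a xor c)) ≡ b xor c
    cancel false b c = refl
    cancel true b c = trans (cong not (sym (BP.not-distribʳ-xor b c))) (BP.not-involutive (b xor c))

listSum-concatMap : ∀ {A B : Set} (h : B → Bool) (f : A → List B) (xs : List A) →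
                    listSum h (concatMap f xs) ≡ listSum (listSum h ∘ f) xs
listSum-concatMap h f [] = refl
listSum-concatMap h f (x ∷ xs) =
  trans (listSum-++ h (f x) (concatMap f xs)) (cong (listSum h (f x) xor_) (listSum-concatMap h f xs))

listSum-map : ∀ {A B : Set} (h : B → Bool) (f : A → B) (xs : List A) → listSum h (List.map f xs) ≡ listSum (h ∘ f) xs
listSum-map h f [] = refl
listSum-map h f (x ∷ xs) = cong (h (f x) xor_) (listSum-map h f xs)

listSum-tabulate : ∀ {n} {A : Set} (h : A → Bool) (f : Fin n → A) → listSum h (List.tabulate f) ≡ sum (h ∘ f)
listSum-tabulate {zero} h f = refl
listSum-tabulate {suc n} h f = cong (h (f zero) xor_) (listSum-tabulate h (f ∘ suc))

listSum-allFin : ∀ {n} (h : Fin n → Bool) → listSum h (allFin n) ≡ sum h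
listSum-allFin h = listSum-tabulate h (λ i → i)

listSum-cong : ∀ {A : Set} {h g : A → Bool} → (∀ x → h x ≡ g x) → (xs : List A) → listSum h xs ≡ listSum g xs
listSum-cong eq [] = refl
listSum-cong eq (x ∷ xs) = cong₂ _xor_ (eq x) (listSum-cong eq xs)

listSum-allFin-≗ : ∀ {n} {h g : Fin n → Bool} → (∀ i → h i ≡ g i) → listSum h (allFin n) ≡ sum g
listSum-allFin-≗ {h = h} eq = trans (listSum-allFin h) (sum-cong-≗ eq)

listSum-pairs : ∀ {n} (h : Fin n × Fin n → Bool) → listSum h (pairs n) ≡ sum λ i → sum λ j → h (i , j)
listSum-pairs {n} h = trans (listSum-concatMap h _ (allFin n)) (listSum-allFin-≗ λ i →
  trans (listSum-map h (i ,_) (allFin n)) (listSum-allFin-≗ {n} λ _ → refl))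

parity≡sum³ : ∀ {n} (P : Fin n × Fin n × Fin n → Bool) → parity P ≡ sum³ λ i j k → P (i , j , k)
parity≡sum³ {n} P = trans (listSum-concatMap P _ (allFin n)) (listSum-allFin-≗ λ i →
  trans (listSum-concatMap P _ (allFin n)) (listSum-allFin-≗ λ j →
  trans (listSum-map P (λ k → i , j , k) (allFin n)) (listSum-allFin-≗ {n} λ _ → refl)))

parity-via-sum³ : ∀ {n} (F : Fin n → Fin n → Fin n → Bool) {b : Bool} →
                  sum³ F ≡ b → parity (λ t → F (proj₁ t) (proj₁ (proj₂ t)) (proj₂ (proj₂ t))) ≡ b
parity-via-sum³ F eq = trans (parity≡sum³ (λ t → F (proj₁ t) (proj₁ (proj₂ t)) (proj₂ (proj₂ t)))) eq

sum³-via-parity : ∀ {n} (F : Fin n → Fin n → Fin n → Bool) {b : Bool} →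
                  parity (λ t → F (proj₁ t) (proj₁ (proj₂ t)) (proj₂ (proj₂ t))) ≡ b → sum³ F ≡ b
sum³-via-parity F eq = trans (sym (parity≡sum³ (λ t → F (proj₁ t) (proj₁ (proj₂ t)) (proj₂ (proj₂ t))))) eq

module _ {n : ℕ} where

  coeff-++ : (p q : Poly n) (m : Mon n) → coeff (p ++ q) m ≡ coeff p m xor coeff q m
  coeff-++ p q m = listSum-++ (m ≟M_) p q

  coeff-*P : (p q : Poly n) (m : Mon n) →
             coeff (p *P q) m ≡ listSum (λ u → listSum (λ v → m ≟M u *M v) q) p
  coeff-*P p q m = trans (listSum-concatMap (m ≟M_) _ p)
                         (listSum-cong (λ u → listSum-map (m ≟M_) (u *M_) q) p)

  occurs-split : (u : Mon n) (r : Poly n) → coeff r u ≡ true → ∃[ xs ] ∃[ ys ] r ≡ xs ++ u ∷ ys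
  occurs-split u [] ()
  occurs-split u (v ∷ r) occ with VecP.≡-dec ℕ._≟_ u v
  ... | yes refl = [] , r , refl
  ... | no _ with occurs-split u r occ
  ...   | xs , ys , refl = v ∷ xs , ys , refl

  head-recurs : (u : Mon n) (r : Poly n) → coeff (u ∷ r) u ≡ false → coeff r u ≡ true
  head-recurs u r z = trans (sym (BP.not-involutive _))
    (cong not (trans (cong (_xor coeff r u) (sym (≟M-refl u))) z))

  listSum-vanishing : (h : Mon n → Bool) (p : Poly n) → p ≈P 0P → listSum h p ≡ false
  listSum-vanishing h p = go (length p) p ℕP.≤-refl
    where
    go : ∀ k (p : Poly n) → length p ≤ k → p ≈P 0P → listSum h p ≡ false
    go _ [] _ _ = refl
    go zero (u ∷ r) () _
    go (suc k) (u ∷ r) (s≤s len) z with occurs-split u r (head-recurs u r (z u))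
    ... | xs , ys , refl =
      trans (listSum-cancel-pair h u xs ys)
            (go k (xs ++ ys) (ℕP.≤-trans (ℕP.n≤1+n _) (subst (_≤ k) (ListP.length-++-sucʳ xs u ys) len))
                (λ m → trans (sym (listSum-cancel-pair (m ≟M_) u xs ys)) (z m)))

  listSum-resp-≈P : {p q : Poly n} → p ≈P q → (h : Mon n → Bool) → listSum h p ≡ listSum h q
  listSum-resp-≈P {p} {q} p≈q h = xor≡false⇒≡ (trans (sym (listSum-++ h p q))
    (listSum-vanishing h (p ++ q) λ m →
      trans (coeff-++ p q m) (trans (cong (_xor coeff q m) (p≈q m)) (BP.xor-same (coeff q m)))))

  affine : Bool → (Fin n → Bool) → Poly n
  affine c β = (if c then 0M ∷ [] else []) ++ concatMap (λ k → if β k then e k ∷ [] else []) (allFin n)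

  listSum-if : (h : Mon n → Bool) (b : Bool) (u : Mon n) → listSum h (if b then u ∷ [] else []) ≡ b ∧ h u
  listSum-if h true u = BP.xor-identityʳ (h u)
  listSum-if h false u = refl

  listSum-affine : (h : Mon n → Bool) (c : Bool) (β : Fin n → Bool) →
                   listSum h (affine c β) ≡ (c ∧ h 0M) xor sum (λ k → β k ∧ h (e k))
  listSum-affine h c β = trans (listSum-++ h (if c then 0M ∷ [] else []) _)
    (cong₂ _xor_ (listSum-if h c 0M)
                 (trans (listSum-concatMap h _ (allFin n)) (listSum-allFin-≗ λ k → listSum-if h (β k) (e k))))

  coeff-affine-deg≥2 : (c : Bool) (β : Fin n → Bool) (m : Mon n) → mdeg m ≢ 0 → mdeg m ≢ 1 →
                       coeff (affine c β) m ≡ false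
  coeff-affine-deg≥2 c β m ≢0 ≢1 = trans (listSum-affine (m ≟M_) c β)
    (cong₂ _xor_ (trans (cong (c ∧_) (≟M-deg {m = m} {w = 0M} λ eq → ≢0 (trans eq (mdeg-0M {n})))) (BP.∧-zeroʳ c))
                 (sum-zero λ k → trans (cong (β k ∧_) (≟M-deg {m = m} {w = e k} λ eq → ≢1 (trans eq (mdeg-e k))))
                                       (BP.∧-zeroʳ (β k))))

  affine-deg≤1 : (c : Bool) (β : Fin n → Bool) → DegLe (affine c β) 1
  affine-deg≤1 c β m nonzero with mdeg m in eq
  ... | 0 = ℕ.z≤n
  ... | 1 = ℕP.≤-refl
  ... | suc (suc _) = ⊥-elim (BP.not-¬ refl (trans (sym nonzero)
        (coeff-affine-deg≥2 c β m (λ eq′ → ℕP.0≢1+n (trans (sym eq′) eq))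
                                  (λ eq′ → ℕP.0≢1+n (ℕP.suc-injective (trans (sym eq′) eq))))))

  affine-expansion : (p : Poly n) → DegLe p 1 → p ≈P affine (coeff p 0M) (λ k → coeff p (e k))
  affine-expansion p deg m = sym (expansion m (mdeg m) refl)
    where
    c : Bool
    c = coeff p 0M
    β : Fin n → Bool
    β k = coeff p (e k)
    expansion : ∀ m d → mdeg m ≡ d → coeff (affine c β) m ≡ coeff p m
    expansion m 0 deg-m with mdeg≡0⇒≡0M m deg-m
    ... | refl = trans (listSum-affine (0M ≟M_) c β)
      (trans (cong₂ _xor_ (trans (cong (c ∧_) (≟M-refl (0M {n}))) (BP.∧-identityʳ c))
                          (sum-zero λ k → trans (cong (β k ∧_) (≟M-deg {m = 0M} {w = e k}
                             λ eq → ℕP.0≢1+n (trans (sym (mdeg-0M {n})) (trans eq (mdeg-e k)))))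
                             (BP.∧-zeroʳ (β k))))
             (BP.xor-identityʳ c))
    expansion m 1 deg-m with mdeg≡1⇒≡e m deg-m
    ... | x , refl = trans (listSum-affine (e x ≟M_) c β)
      (cong₂ _xor_ (trans (cong (c ∧_) (≟M-deg {m = e x} {w = 0M}
                            λ eq → ℕP.0≢1+n (trans (sym (mdeg-0M {n})) (trans (sym eq) (mdeg-e x)))))
                          (BP.∧-zeroʳ c))
                   (trans (sum-cong-≗ λ k → trans (cong (β k ∧_) (≟M-e x k)) (BP.∧-comm (β k) (δ k x)))
                          (∑-δ x β)))
    expansion m (suc (suc d)) deg-m =
      trans (coeff-affine-deg≥2 c β m (λ eq → ℕP.0≢1+n (trans (sym eq) deg-m))
                                      (λ eq → ℕP.0≢1+n (ℕP.suc-injective (trans (sym eq) deg-m))))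
            (sym vanishes)
      where
      vanishes : coeff p m ≡ false
      vanishes with coeff p m in c≡
      ... | false = refl
      ... | true with subst (_≤ 1) deg-m (deg m c≡)
      ...   | s≤s ()

coeff³ : ∀ {n} → (Fin n → Fin n → Fin n → Bool) → Mon n → Bool
coeff³ w m = sum³ λ x y z → (m ≟M cubic x y z) ∧ w x y z

module _ {n : ℕ} (w : Fin n → Fin n → Fin n → Bool) where

  ∑³-δ³ : (p q r : Fin n) → sum³ (λ x y z → δ³ x y z p q r ∧ w x y z) ≡ w p q r
  ∑³-δ³ p q r = begin
    sum³ (λ x y z → δ³ x y z p q r ∧ w x y z)
      ≡⟨ sum³-cong (λ x y z → trans (BP.∧-assoc (δ x p) _ _) (cong (δ x p ∧_) (BP.∧-assoc (δ y q) _ _))) ⟩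
    sum³ (λ x y z → δ x p ∧ (δ y q ∧ (δ z r ∧ w x y z)))
      ≡⟨ sum-cong-≗ (λ x → trans (sum-cong-≗ λ y → sym (*-distribˡ-sum (δ x p) (G x y)))
                                 (sym (*-distribˡ-sum (δ x p) (λ y → sum (G x y))))) ⟩
    sum (λ x → δ x p ∧ sum λ y → sum (G x y))
      ≡⟨ ∑-δ p (λ x → sum λ y → sum (G x y)) ⟩
    sum (λ y → sum (G p y))
      ≡⟨ sum-cong-≗ (λ y → sym (*-distribˡ-sum (δ y q) (λ z → δ z r ∧ w p y z))) ⟩
    sum (λ y → δ y q ∧ sum λ z → δ z r ∧ w p y z)
      ≡⟨ ∑-δ q (λ y → sum λ z → δ z r ∧ w p y z) ⟩
    sum (λ z → δ z r ∧ w p q z)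
      ≡⟨ ∑-δ r (w p q) ⟩
    w p q r ∎
    where
    open ≡-Reasoning
    G : Fin n → Fin n → Fin n → Bool
    G x y z = δ y q ∧ (δ z r ∧ w x y z)

  ∑³-δ³-xor : (p q r : Fin n) (F : Fin n → Fin n → Fin n → Bool) →
              sum³ (λ x y z → (δ³ x y z p q r xor F x y z) ∧ w x y z) ≡
              w p q r xor sum³ (λ x y z → F x y z ∧ w x y z)
  ∑³-δ³-xor p q r F =
    trans (sum³-cong λ x y z → BP.∧-distribʳ-xor (w x y z) (δ³ x y z p q r) (F x y z))
          (trans (sum³-xor (λ x y z → δ³ x y z p q r ∧ w x y z) (λ x y z → F x y z ∧ w x y z))
                 (cong (_xor sum³ (λ x y z → F x y z ∧ w x y z)) (∑³-δ³ p q r)))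

  coeff³-aaa : (a : Fin n) → coeff³ w (cubic a a a) ≡ w a a a
  coeff³-aaa a = trans (sum³-cong λ x y z → cong (_∧ w x y z) (≟M-cubic-aaa a x y z)) (∑³-δ³ a a a)

  coeff³-abb : {a b : Fin n} → a ≢ b → coeff³ w (cubic a b b) ≡ w a b b xor (w b a b xor w b b a)
  coeff³-abb {a} {b} a≢b =
    trans (sum³-cong λ x y z → cong (_∧ w x y z) (≟M-cubic-abb a≢b x y z))
    (trans (∑³-δ³-xor a b b _) (cong (w a b b xor_)
    (trans (∑³-δ³-xor b a b _) (cong (w b a b xor_) (∑³-δ³ b b a)))))

  coeff³-abc : {a b c : Fin n} → a ≢ b → a ≢ c → b ≢ c →
               coeff³ w (cubic a b c) ≡
                 w a b c xor (w a c b xor (w b a c xor (w b c a xor (w c a b xor w c b a))))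
  coeff³-abc {a} {b} {c} a≢b a≢c b≢c =
    trans (sum³-cong λ x y z → cong (_∧ w x y z) (≟M-cubic-abc a≢b a≢c b≢c x y z))
    (trans (∑³-δ³-xor a b c _) (cong (w a b c xor_)
    (trans (∑³-δ³-xor a c b _) (cong (w a c b xor_)
    (trans (∑³-δ³-xor b a c _) (cong (w b a c xor_)
    (trans (∑³-δ³-xor b c a _) (cong (w b c a xor_)
    (trans (∑³-δ³-xor c a b _) (cong (w c a b xor_) (∑³-δ³ c b a)))))))))))

sym₁₂ : ∀ {n} → (Fin n → Fin n → Fin n → Bool) → Fin n → Fin n → Fin n → Bool
sym₁₂ g i j k = g i j k xor g j i k

edgeCubic : ∀ {n} → Mon n → Fin n → Fin n → Fin n → Bool
edgeCubic m i j k = (m ≟M cubic k i i) xor ((m ≟M cubic k i j) xor (m ≟M cubic k j j))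

edgeCubic-off : ∀ {n} (m : Mon n) {d} → mdeg m ≡ d → d ≢ 3 → ∀ i j k → edgeCubic m i j k ≡ false
edgeCubic-off m deg-m d≢3 i j k = cong₂ _xor_ (off k i i) (cong₂ _xor_ (off k i j) (off k j j))
  where
  off : ∀ x y z → (m ≟M cubic x y z) ≡ false
  off x y z = ≟M-degrees m (cubic x y z) deg-m (mdeg-cubic x y z) d≢3

cubicPart : ∀ {n} → (Fin n → Bool) → (Fin n → Fin n → Fin n → Bool) → Mon n → Bool
cubicPart γ g m = sum (λ i → γ i ∧ (m ≟M cubic i i i)) xor sum³ (λ i j k → g i j k ∧ edgeCubic m i j k)

module _ {n : ℕ} (γ : Fin n → Bool) (g : Fin n → Fin n → Fin n → Bool) where

  cubicPart-vanish : (m : Mon n) → mdeg m ≢ 3 → cubicPart γ g m ≡ false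
  cubicPart-vanish m ≢3 = cong₂ _xor_
    (sum-zero λ i → trans (cong (γ i ∧_) (≟M-degrees m (cubic i i i) refl (mdeg-cubic i i i) ≢3)) (BP.∧-zeroʳ (γ i)))
    (sum³-zero λ i j k → trans (cong (g i j k ∧_) (edgeCubic-off m refl ≢3 i j k)) (BP.∧-zeroʳ (g i j k)))

  private
    β : Fin n → Fin n → Bool
    β i k = sum λ j → sym₁₂ g i j k

    W₁ W₂ W₃ : Fin n → Fin n → Fin n → Bool
    W₁ x y z = δ z y ∧ (δ y x ∧ γ x)
    W₂ x y z = δ z y ∧ β y x
    W₃ x y z = g y z x

    vertex-normal : (m : Mon n) → sum (λ i → γ i ∧ (m ≟M cubic i i i)) ≡ coeff³ W₁ m
    vertex-normal m = sym (trans (sum-cong-≗ λ x →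
      trans (sum-cong-≗ λ y → ∑-diag (λ z → m ≟M cubic x y z) y (δ y x ∧ γ x))
            (∑-diag (λ y → m ≟M cubic x y y) x (γ x)))
      (sum-cong-≗ λ x → BP.∧-comm (m ≟M cubic x x x) (γ x)))

    squares-normal : (m : Mon n) →
      sum³ (λ i j k → g i j k ∧ ((m ≟M cubic k i i) xor (m ≟M cubic k j j))) ≡ coeff³ W₂ m
    squares-normal m = begin
      sum³ (λ i j k → g i j k ∧ ((m ≟M cubic k i i) xor (m ≟M cubic k j j)))
        ≡⟨ sum³-cong (λ i j k → BP.∧-distribˡ-xor (g i j k) _ _) ⟩
      sum³ (λ i j k → (g i j k ∧ (m ≟M cubic k i i)) xor (g i j k ∧ (m ≟M cubic k j j)))
        ≡⟨ sum³-xor (λ i j k → g i j k ∧ (m ≟M cubic k i i)) (λ i j k → g i j k ∧ (m ≟M cubic k j j)) ⟩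
      sum³ (λ i j k → g i j k ∧ (m ≟M cubic k i i)) xor sum³ (λ i j k → g i j k ∧ (m ≟M cubic k j j))
        ≡⟨ cong (sum³ (λ i j k → g i j k ∧ (m ≟M cubic k i i)) xor_)
                (∑-comm (λ i j → sum λ k → g i j k ∧ (m ≟M cubic k j j))) ⟩
      sum³ (λ i j k → g i j k ∧ (m ≟M cubic k i i)) xor sum³ (λ i j k → g j i k ∧ (m ≟M cubic k i i))
        ≡⟨ sum³-xor (λ i j k → g i j k ∧ (m ≟M cubic k i i)) (λ i j k → g j i k ∧ (m ≟M cubic k i i)) ⟨
      sum³ (λ i j k → (g i j k ∧ (m ≟M cubic k i i)) xor (g j i k ∧ (m ≟M cubic k i i)))
        ≡⟨ sum³-cong (λ i j k → BP.∧-distribʳ-xor (m ≟M cubic k i i) (g i j k) (g j i k)) ⟨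
      sum³ (λ i j k → sym₁₂ g i j k ∧ (m ≟M cubic k i i))
        ≡⟨ sum-cong-≗ (λ i → ∑-comm (λ j k → sym₁₂ g i j k ∧ (m ≟M cubic k i i))) ⟩
      sum (λ i → sum λ k → sum λ j → sym₁₂ g i j k ∧ (m ≟M cubic k i i))
        ≡⟨ sum-cong-≗ (λ i → sum-cong-≗ λ k → *-distribʳ-sum (m ≟M cubic k i i) (λ j → sym₁₂ g i j k)) ⟨
      sum (λ i → sum λ k → β i k ∧ (m ≟M cubic k i i))
        ≡⟨ ∑-comm (λ i k → β i k ∧ (m ≟M cubic k i i)) ⟩
      sum (λ x → sum λ y → β y x ∧ (m ≟M cubic x y y))
        ≡⟨ sum-cong-≗ (λ x → sum-cong-≗ λ y → BP.∧-comm (β y x) _) ⟩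
      sum (λ x → sum λ y → (m ≟M cubic x y y) ∧ β y x)
        ≡⟨ sum-cong-≗ (λ x → sum-cong-≗ λ y → ∑-diag (λ z → m ≟M cubic x y z) y (β y x)) ⟨
      coeff³ W₂ m ∎
      where open ≡-Reasoning

    mixed-normal : (m : Mon n) → sum³ (λ i j k → g i j k ∧ (m ≟M cubic k i j)) ≡ coeff³ W₃ m
    mixed-normal m = begin
      sum³ (λ i j k → g i j k ∧ (m ≟M cubic k i j))
        ≡⟨ sum-cong-≗ (λ i → ∑-comm (λ j k → g i j k ∧ (m ≟M cubic k i j))) ⟩
      sum (λ i → sum λ k → sum λ j → g i j k ∧ (m ≟M cubic k i j))
        ≡⟨ ∑-comm (λ i k → sum λ j → g i j k ∧ (m ≟M cubic k i j)) ⟩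
      sum³ (λ x y z → g y z x ∧ (m ≟M cubic x y z))
        ≡⟨ sum³-cong (λ x y z → BP.∧-comm (g y z x) _) ⟩
      coeff³ W₃ m ∎
      where open ≡-Reasoning

  cubicPart-normal : (m : Mon n) → cubicPart γ g m ≡ coeff³ W₁ m xor (coeff³ W₂ m xor coeff³ W₃ m)
  cubicPart-normal m = cong₂ _xor_ (vertex-normal m) (begin
    sum³ (λ i j k → g i j k ∧ edgeCubic m i j k)
      ≡⟨ sum³-cong (λ i j k → trans (cong (g i j k ∧_) (regroup (m ≟M cubic k i i) (m ≟M cubic k i j) (m ≟M cubic k j j)))
                                    (BP.∧-distribˡ-xor (g i j k) _ _)) ⟩
    sum³ (λ i j k → (g i j k ∧ ((m ≟M cubic k i i) xor (m ≟M cubic k j j))) xor (g i j k ∧ (m ≟M cubic k i j)))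
      ≡⟨ sum³-xor (λ i j k → g i j k ∧ ((m ≟M cubic k i i) xor (m ≟M cubic k j j))) (λ i j k → g i j k ∧ (m ≟M cubic k i j)) ⟩
    sum³ (λ i j k → g i j k ∧ ((m ≟M cubic k i i) xor (m ≟M cubic k j j))) xor sum³ (λ i j k → g i j k ∧ (m ≟M cubic k i j))
      ≡⟨ cong₂ _xor_ (squares-normal m) (mixed-normal m) ⟩
    coeff³ W₂ m xor coeff³ W₃ m ∎)
    where
    open ≡-Reasoning
    regroup : ∀ x y z → x xor (y xor z) ≡ (x xor z) xor y
    regroup = solve 3 (λ x y z → x ⊕ (y ⊕ z) ⊜ (x ⊕ z) ⊕ y) refl

  module _ (g-irrefl : ∀ i k → g i i k ≡ false) where

    cubicPart-aaa : (a : Fin n) → cubicPart γ g (cubic a a a) ≡ γ a xor sum (λ j → sym₁₂ g a j a)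
    cubicPart-aaa a = begin
      cubicPart γ g (cubic a a a)
        ≡⟨ cubicPart-normal (cubic a a a) ⟩
      coeff³ W₁ (cubic a a a) xor (coeff³ W₂ (cubic a a a) xor coeff³ W₃ (cubic a a a))
        ≡⟨ cong₂ _xor_ (coeff³-aaa W₁ a) (cong₂ _xor_ (coeff³-aaa W₂ a) (coeff³-aaa W₃ a)) ⟩
      W₁ a a a xor (W₂ a a a xor g a a a)
        ≡⟨ cong₂ _xor_ (trans (δ-refl-∧ a _) (δ-refl-∧ a (γ a)))
                       (trans (cong₂ _xor_ (δ-refl-∧ a (β a a)) (g-irrefl a a)) (BP.xor-identityʳ (β a a))) ⟩
      γ a xor β a a ∎
      where open ≡-Reasoning

    cubicPart-abb : {a b : Fin n} → a ≢ b →
                    cubicPart γ g (cubic a b b) ≡ sum (λ j → sym₁₂ g b j a) xor sym₁₂ g a b b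
    cubicPart-abb {a} {b} a≢b = begin
      cubicPart γ g (cubic a b b)
        ≡⟨ cubicPart-normal (cubic a b b) ⟩
      coeff³ W₁ (cubic a b b) xor (coeff³ W₂ (cubic a b b) xor coeff³ W₃ (cubic a b b))
        ≡⟨ cong₂ _xor_ (coeff³-abb W₁ a≢b) (cong₂ _xor_ (coeff³-abb W₂ a≢b) (coeff³-abb W₃ a≢b)) ⟩
      (W₁ a b b xor (W₁ b a b xor W₁ b b a)) xor
        ((W₂ a b b xor (W₂ b a b xor W₂ b b a)) xor (g b b a xor sym₁₂ g a b b))
        ≡⟨ cong₂ _xor_ (cong₂ _xor_ (trans (δ-refl-∧ b _) (δ-≢-∧ b≢a (γ a)))
                                    (cong₂ _xor_ (δ-≢-∧ b≢a _) (δ-≢-∧ a≢b _)))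
                       (cong₂ _xor_ (cong₂ _xor_ (δ-refl-∧ b (β b a)) (cong₂ _xor_ (δ-≢-∧ b≢a _) (δ-≢-∧ a≢b _)))
                                    (cong (_xor sym₁₂ g a b b) (g-irrefl b a))) ⟩
      (β b a xor false) xor sym₁₂ g a b b
        ≡⟨ cong (_xor sym₁₂ g a b b) (BP.xor-identityʳ (β b a)) ⟩
      β b a xor sym₁₂ g a b b ∎
      where
      open ≡-Reasoning
      b≢a = a≢b ∘ sym

    cubicPart-abc : {a b c : Fin n} → a ≢ b → a ≢ c → b ≢ c →
                    cubicPart γ g (cubic a b c) ≡ sym₁₂ g a b c xor (sym₁₂ g b c a xor sym₁₂ g a c b)
    cubicPart-abc {a} {b} {c} a≢b a≢c b≢c = begin
      cubicPart γ g (cubic a b c)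
        ≡⟨ cubicPart-normal (cubic a b c) ⟩
      coeff³ W₁ (cubic a b c) xor (coeff³ W₂ (cubic a b c) xor coeff³ W₃ (cubic a b c))
        ≡⟨ cong₂ _xor_ (trans (coeff³-abc W₁ a≢b a≢c b≢c) (off-diagonal W₁ λ x {y} {z} z≢y → δ-≢-∧ z≢y _))
                       (cong₂ _xor_ (trans (coeff³-abc W₂ a≢b a≢c b≢c) (off-diagonal W₂ λ x z≢y → δ-≢-∧ z≢y _))
                                    (coeff³-abc W₃ a≢b a≢c b≢c)) ⟩
      g b c a xor (g c b a xor (g a c b xor (g c a b xor (g a b c xor g b a c))))
        ≡⟨ solve 6 (λ p₁ p₂ p₃ p₄ p₅ p₆ → p₁ ⊕ (p₂ ⊕ (p₃ ⊕ (p₄ ⊕ (p₅ ⊕ p₆)))) ⊜ (p₅ ⊕ p₆) ⊕ ((p₁ ⊕ p₂) ⊕ (p₃ ⊕ p₄)))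
                   refl (g b c a) (g c b a) (g a c b) (g c a b) (g a b c) (g b a c) ⟩
      sym₁₂ g a b c xor (sym₁₂ g b c a xor sym₁₂ g a c b) ∎
      where
      open ≡-Reasoning
      off-diagonal : (W : Fin n → Fin n → Fin n → Bool) → (∀ x {y z} → z ≢ y → W x y z ≡ false) →
                     W a b c xor (W a c b xor (W b a c xor (W b c a xor (W c a b xor W c b a)))) ≡ false
      off-diagonal W vanish =
        cong₂ _xor_ (vanish a (b≢c ∘ sym)) (cong₂ _xor_ (vanish a b≢c) (cong₂ _xor_ (vanish b (a≢c ∘ sym))
          (cong₂ _xor_ (vanish b a≢c) (cong₂ _xor_ (vanish c (a≢b ∘ sym)) (vanish c a≢b)))))

module _ {n : ℕ} where

  mdeg-e*M : (k : Fin n) (w : Mon n) → mdeg (e k *M w) ≡ suc (mdeg w)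
  mdeg-e*M k w = trans (mdeg-*M (e k) w) (cong (_+ mdeg w) (mdeg-e k))

  vertexConstant : Mon n → Fin n → Bool
  vertexConstant m i = (m ≟M cubic i i i) xor (m ≟M 0M)

  vertexLinear : Mon n → Fin n → Fin n → Bool
  vertexLinear m i k = (m ≟M e k *M cubic i i i) xor (m ≟M e k)

  edgeQuadratic : Mon n → Fin n → Fin n → Bool
  edgeQuadratic m i j = (m ≟M e i *M e i) xor ((m ≟M e i *M e j) xor (m ≟M e j *M e j))

  module _ (m : Mon n) {d : ℕ} (deg-m : mdeg m ≡ d) where

    vertexLinear-off : d ≢ 4 → d ≢ 1 → ∀ i k → vertexLinear m i k ≡ false
    vertexLinear-off d≢4 d≢1 i k = cong₂ _xor_
      (≟M-degrees m (e k *M cubic i i i) deg-m (trans (mdeg-e*M k (cubic i i i)) (cong suc (mdeg-cubic i i i))) d≢4)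
      (≟M-degrees m (e k) deg-m (mdeg-e k) d≢1)

    edgeQuadratic-off : d ≢ 2 → ∀ i j → edgeQuadratic m i j ≡ false
    edgeQuadratic-off d≢2 i j = cong₂ _xor_ (off i i) (cong₂ _xor_ (off i j) (off j j))
      where
      off : ∀ x y → (m ≟M e x *M e y) ≡ false
      off x y = ≟M-degrees m (e x *M e y) deg-m (trans (mdeg-e*M x (e y)) (cong suc (mdeg-e y))) d≢2


  coeff-affine-*P : {α : Poly n} {c : Bool} {β : Fin n → Bool} → α ≈P affine c β → (q : Poly n) (m : Mon n) →
    coeff (α *P q) m ≡
      (c ∧ listSum (λ v → m ≟M 0M *M v) q) xor sum (λ k → β k ∧ listSum (λ v → m ≟M e k *M v) q)
  coeff-affine-*P {α} {c} {β} α≈ q m = trans (coeff-*P α q m)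
    (trans (listSum-resp-≈P {p = α} {q = affine c β} α≈ (λ u → listSum (λ v → m ≟M u *M v) q))
           (listSum-affine (λ u → listSum (λ v → m ≟M u *M v) q) c β))

  coeff-affine-*P-vertex : {α : Poly n} {c : Bool} {β : Fin n → Bool} → α ≈P affine c β → (i : Fin n) (m : Mon n) →
    coeff (α *P vertexPoly i) m ≡ (c ∧ vertexConstant m i) xor sum (λ k → β k ∧ vertexLinear m i k)
  coeff-affine-*P-vertex {α} {c} {β} α≈ i m = trans (coeff-affine-*P {α = α} {c = c} {β = β} α≈ (vertexPoly i) m)
    (cong₂ _xor_ (cong (c ∧_) (cong₂ _xor_ (cong (m ≟M_) (trans (*M-identityˡ (xpow i 3)) (xpow-3 i)))
                                            (trans (BP.xor-identityʳ _) (cong (m ≟M_) (*M-identityˡ 0M)))))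
                 (sum-cong-≗ λ k → cong (β k ∧_) (cong₂ _xor_ (cong (λ w → m ≟M e k *M w) (xpow-3 i))
                                            (trans (BP.xor-identityʳ _) (cong (m ≟M_) (*M-identityʳ (e k)))))))

  coeff-affine-*P-edge : {α : Poly n} {c : Bool} {β : Fin n → Bool} → α ≈P affine c β → (i j : Fin n) (m : Mon n) →
    coeff (α *P edgePoly i j) m ≡ (c ∧ edgeQuadratic m i j) xor sum (λ k → β k ∧ edgeCubic m i j k)
  coeff-affine-*P-edge {α} {c} {β} α≈ i j m = trans (coeff-affine-*P {α = α} {c = c} {β = β} α≈ (edgePoly i j) m)
    (cong₂ _xor_
      (cong (c ∧_) (cong₂ _xor_ (cong (m ≟M_) (trans (*M-identityˡ (xpow i 2)) (xpow-2 i)))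
        (cong₂ _xor_ (cong (m ≟M_) (*M-identityˡ (xx i j)))
                     (trans (BP.xor-identityʳ _) (cong (m ≟M_) (trans (*M-identityˡ (xpow j 2)) (xpow-2 j)))))))
      (sum-cong-≗ λ k → cong (β k ∧_) (cong₂ _xor_ (cong (λ w → m ≟M e k *M w) (xpow-2 i))
        (cong ((m ≟M cubic k i j) xor_) (trans (BP.xor-identityʳ _) (cong (λ w → m ≟M e k *M w) (xpow-2 j)))))))

coeff-combo : (G : Graph) (αV : Fin (n G) → Poly (n G)) (αE : Fin (n G) → Fin (n G) → Poly (n G)) (m : Mon (n G)) →
  coeff (combo G αV αE) m ≡
    sum (λ i → coeff (αV i *P vertexPoly i) m) xor
    sum (λ i → sum λ j → isEdgeIdx G i j ∧ coeff (αE i j *P edgePoly i j) m)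
coeff-combo G αV αE m = trans (coeff-++ (ΣP (allFin (n G)) (λ i → αV i *P vertexPoly i)) _ m)
  (cong₂ _xor_
    (trans (listSum-concatMap (m ≟M_) _ (allFin (n G))) (listSum-allFin (λ i → coeff (αV i *P vertexPoly i) m)))
    (trans (listSum-concatMap (m ≟M_) _ (pairs (n G)))
           (trans (listSum-pairs (λ p → coeff (edgeTerm (proj₁ p) (proj₂ p)) m))
                  (sum-cong-≗ λ i → sum-cong-≗ λ j → edge-term i j))))
  where
  edgeTerm : Fin (n G) → Fin (n G) → Poly (n G)
  edgeTerm i j = if isEdgeIdx G i j then αE i j *P edgePoly i j else 0P
  edge-term : ∀ i j → coeff (edgeTerm i j) m ≡ isEdgeIdx G i j ∧ coeff (αE i j *P edgePoly i j) m
  edge-term i j with isEdgeIdx G i j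
  ... | true = refl
  ... | false = refl

module AffineCombination (G : Graph)
  (αV : Fin (n G) → Poly (n G)) (αE : Fin (n G) → Fin (n G) → Poly (n G))
  (cV : Fin (n G) → Bool) (aV : Fin (n G) → Fin (n G) → Bool)
  (cE : Fin (n G) → Fin (n G) → Bool) (bE : Fin (n G) → Fin (n G) → Fin (n G) → Bool)
  (αV≈ : ∀ i → αV i ≈P affine (cV i) (aV i))
  (αE≈ : ∀ i j → isEdgeIdx G i j ≡ true → αE i j ≈P affine (cE i j) (bE i j)) where

  edgeWeight : Fin (n G) → Fin (n G) → Fin (n G) → Bool
  edgeWeight i j k = isEdgeIdx G i j ∧ bE i j k

  private
    vertexCoeff : Mon (n G) → Fin (n G) → Bool
    vertexCoeff m i = (cV i ∧ vertexConstant m i) xor sum (λ k → aV i k ∧ vertexLinear m i k)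

    edgeCoeff : Mon (n G) → Fin (n G) → Fin (n G) → Bool
    edgeCoeff m i j = (cE i j ∧ edgeQuadratic m i j) xor sum (λ k → bE i j k ∧ edgeCubic m i j k)

    coeff-combo-affine : (m : Mon (n G)) → coeff (combo G αV αE) m ≡
      sum (vertexCoeff m) xor sum (λ i → sum λ j → isEdgeIdx G i j ∧ edgeCoeff m i j)
    coeff-combo-affine m = trans (coeff-combo G αV αE m)
      (cong₂ _xor_ (sum-cong-≗ λ i → coeff-affine-*P-vertex {α = αV i} {c = cV i} {β = aV i} (αV≈ i) i m)
                   (sum-cong-≗ λ i → sum-cong-≗ λ j → edge i j))
      where
      edge : ∀ i j → isEdgeIdx G i j ∧ coeff (αE i j *P edgePoly i j) m ≡ isEdgeIdx G i j ∧ edgeCoeff m i j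
      edge i j with isEdgeIdx G i j in eq
      ... | false = refl
      ... | true = coeff-affine-*P-edge {α = αE i j} {c = cE i j} {β = bE i j} (αE≈ i j eq) i j m

    linear-off : (m : Mon (n G)) → (∀ i k → vertexLinear m i k ≡ false) → ∀ i →
                 sum (λ k → aV i k ∧ vertexLinear m i k) ≡ false
    linear-off m off i = sum-zero λ k → trans (cong (aV i k ∧_) (off i k)) (BP.∧-zeroʳ (aV i k))

    edge-part : (m : Mon (n G)) → (∀ i j → cE i j ∧ edgeQuadratic m i j ≡ false) →
      sum (λ i → sum λ j → isEdgeIdx G i j ∧ edgeCoeff m i j) ≡ sum³ (λ i j k → edgeWeight i j k ∧ edgeCubic m i j k)
    edge-part m no-quadratic = sum-cong-≗ λ i → sum-cong-≗ λ j → begin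
      isEdgeIdx G i j ∧ edgeCoeff m i j
        ≡⟨ cong (isEdgeIdx G i j ∧_) (cong (_xor sum (λ k → bE i j k ∧ edgeCubic m i j k)) (no-quadratic i j)) ⟩
      isEdgeIdx G i j ∧ sum (λ k → bE i j k ∧ edgeCubic m i j k)
        ≡⟨ *-distribˡ-sum (isEdgeIdx G i j) (λ k → bE i j k ∧ edgeCubic m i j k) ⟩
      sum (λ k → isEdgeIdx G i j ∧ (bE i j k ∧ edgeCubic m i j k))
        ≡⟨ sum-cong-≗ (λ k → BP.∧-assoc (isEdgeIdx G i j) (bE i j k) _) ⟨
      sum (λ k → edgeWeight i j k ∧ edgeCubic m i j k) ∎
      where open ≡-Reasoning

    quadratic-off : (m : Mon (n G)) → (∀ i j → edgeQuadratic m i j ≡ false) → ∀ i j → cE i j ∧ edgeQuadratic m i j ≡ false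
    quadratic-off m off i j = trans (cong (cE i j ∧_) (off i j)) (BP.∧-zeroʳ (cE i j))

  coeff-combo-0 : coeff (combo G αV αE) 0M ≡ sum cV
  coeff-combo-0 = begin
    coeff (combo G αV αE) 0M
      ≡⟨ coeff-combo-affine 0M ⟩
    sum (vertexCoeff 0M) xor sum (λ i → sum λ j → isEdgeIdx G i j ∧ edgeCoeff 0M i j)
      ≡⟨ cong₂ _xor_ (sum-cong-≗ vertex)
                     (trans (edge-part 0M (quadratic-off 0M (edgeQuadratic-off 0M deg-0 λ ())))
                            (sum³-zero λ i j k → trans (cong (edgeWeight i j k ∧_) (edgeCubic-off 0M deg-0 (λ ()) i j k))
                                                       (BP.∧-zeroʳ (edgeWeight i j k)))) ⟩
    sum cV xor false
      ≡⟨ BP.xor-identityʳ (sum cV) ⟩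
    sum cV ∎
    where
    open ≡-Reasoning
    deg-0 : mdeg (0M {n G}) ≡ 0
    deg-0 = mdeg-0M {n G}
    vertex : ∀ i → vertexCoeff 0M i ≡ cV i
    vertex i = trans (cong₂ _xor_ (cong (cV i ∧_) (cong₂ _xor_ (≟M-degrees 0M (cubic i i i) deg-0 (mdeg-cubic i i i) λ ())
                                                              (≟M-refl (0M {n G}))))
                                  (linear-off 0M (vertexLinear-off 0M deg-0 (λ ()) (λ ())) i))
                     (trans (BP.xor-identityʳ _) (BP.∧-identityʳ (cV i)))

  coeff-combo-cubic : (m : Mon (n G)) → mdeg m ≡ 3 → coeff (combo G αV αE) m ≡ cubicPart cV edgeWeight m
  coeff-combo-cubic m deg-m = trans (coeff-combo-affine m)
    (cong₂ _xor_ (sum-cong-≗ vertex) (edge-part m (quadratic-off m (edgeQuadratic-off m deg-m λ ()))))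
    where
    vertex : ∀ i → vertexCoeff m i ≡ cV i ∧ (m ≟M cubic i i i)
    vertex i = trans (cong₂ _xor_ (cong (cV i ∧_) (trans (cong ((m ≟M cubic i i i) xor_)
                                                                (≟M-degrees m 0M deg-m (mdeg-0M {n G}) λ ()))
                                                         (BP.xor-identityʳ _)))
                                  (linear-off m (vertexLinear-off m deg-m (λ ()) (λ ())) i))
                     (BP.xor-identityʳ _)

  coeff-combo-reduced : (∀ i k → aV i k ≡ false) → (∀ i j → cE i j ≡ false) → (m : Mon (n G)) →
    coeff (combo G αV αE) m ≡ ((m ≟M 0M) ∧ sum cV) xor cubicPart cV edgeWeight m
  coeff-combo-reduced aV≡0 cE≡0 m = begin
    coeff (combo G αV αE) m
      ≡⟨ coeff-combo-affine m ⟩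
    sum (vertexCoeff m) xor sum (λ i → sum λ j → isEdgeIdx G i j ∧ edgeCoeff m i j)
      ≡⟨ cong₂ _xor_ (sum-cong-≗ vertex) (edge-part m λ i j → cong (_∧ edgeQuadratic m i j) (cE≡0 i j)) ⟩
    sum (λ i → (cV i ∧ (m ≟M cubic i i i)) xor (cV i ∧ (m ≟M 0M))) xor E
      ≡⟨ cong (_xor E) (∑-distrib-+ (λ i → cV i ∧ (m ≟M cubic i i i)) (λ i → cV i ∧ (m ≟M 0M))) ⟩
    (V xor sum (λ i → cV i ∧ (m ≟M 0M))) xor E
      ≡⟨ cong (λ x → (V xor x) xor E) (trans (BP.∧-comm (m ≟M 0M) (sum cV)) (*-distribʳ-sum (m ≟M 0M) cV)) ⟨
    (V xor ((m ≟M 0M) ∧ sum cV)) xor E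
      ≡⟨ solve 3 (λ x y z → (x ⊕ y) ⊕ z ⊜ y ⊕ (x ⊕ z)) refl V ((m ≟M 0M) ∧ sum cV) E ⟩
    ((m ≟M 0M) ∧ sum cV) xor cubicPart cV edgeWeight m ∎
    where
    open ≡-Reasoning
    V : Bool
    V = sum (λ i → cV i ∧ (m ≟M cubic i i i))
    E : Bool
    E = sum³ (λ i j k → edgeWeight i j k ∧ edgeCubic m i j k)
    vertex : ∀ i → vertexCoeff m i ≡ (cV i ∧ (m ≟M cubic i i i)) xor (cV i ∧ (m ≟M 0M))
    vertex i = trans (cong₂ _xor_ (BP.∧-distribˡ-xor (cV i) _ _)
                                  (sum-zero λ k → cong (_∧ vertexLinear m i k) (aV≡0 i k)))
                     (BP.xor-identityʳ _)

<ᵇ-irrefl : ∀ x → (x <ᵇ x) ≡ false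
<ᵇ-irrefl zero = refl
<ᵇ-irrefl (suc x) = <ᵇ-irrefl x

<ᵇ-asym : ∀ x y → (x <ᵇ y) ∧ (y <ᵇ x) ≡ false
<ᵇ-asym zero zero = refl
<ᵇ-asym zero (suc y) = refl
<ᵇ-asym (suc x) zero = refl
<ᵇ-asym (suc x) (suc y) = <ᵇ-asym x y

<ᵇ-connex : ∀ {x y} → x ≢ y → (x <ᵇ y) xor (y <ᵇ x) ≡ true
<ᵇ-connex {zero} {zero} x≢y = ⊥-elim (x≢y refl)
<ᵇ-connex {zero} {suc y} _ = refl
<ᵇ-connex {suc x} {zero} _ = refl
<ᵇ-connex {suc x} {suc y} x≢y = <ᵇ-connex (x≢y ∘ cong suc)

<ᵇ-trans : ∀ x y z → (x <ᵇ y) ≡ true → (y <ᵇ z) ≡ true → (x <ᵇ z) ≡ true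
<ᵇ-trans x zero z () _
<ᵇ-trans x (suc y) zero _ ()
<ᵇ-trans zero (suc y) (suc z) _ _ = refl
<ᵇ-trans (suc x) (suc y) (suc z) p q = <ᵇ-trans x y z p q

infix 4 _<ᶠ_
_<ᶠ_ : ∀ {n} → Fin n → Fin n → Bool
i <ᶠ j = toℕ i <ᵇ toℕ j

module _ {n : ℕ} where

  <ᶠ-irrefl : (i : Fin n) → (i <ᶠ i) ≡ false
  <ᶠ-irrefl i = <ᵇ-irrefl (toℕ i)

  <ᶠ-asym : (i j : Fin n) → (i <ᶠ j) ∧ (j <ᶠ i) ≡ false
  <ᶠ-asym i j = <ᵇ-asym (toℕ i) (toℕ j)

  <ᶠ-connex : {i j : Fin n} → i ≢ j → (i <ᶠ j) xor (j <ᶠ i) ≡ true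
  <ᶠ-connex i≢j = <ᵇ-connex (i≢j ∘ FinP.toℕ-injective)

  <ᶠ-trans : (i j k : Fin n) → (i <ᶠ j) ≡ true → (j <ᶠ k) ≡ true → (i <ᶠ k) ≡ true
  <ᶠ-trans i j k = <ᵇ-trans (toℕ i) (toℕ j) (toℕ k)

  <ᶠ-flip : {i j : Fin n} → i ≢ j → (j <ᶠ i) ≡ not (i <ᶠ j)
  <ᶠ-flip i≢j = xor≡true⇒≡not (<ᶠ-connex i≢j)

  <ᶠ-≢ : {i j : Fin n} → (i <ᶠ j) ≡ true → i ≢ j
  <ᶠ-≢ {i} i<j refl = BP.not-¬ refl (trans (sym (<ᶠ-irrefl i)) i<j)

  private
    no-cycle : (i j k : Fin n) → (i <ᶠ j) ≡ true → (j <ᶠ k) ≡ true → (k <ᶠ i) ≡ true → ∀ {A : Set} → A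
    no-cycle i j k i<j j<k k<i = ⊥-elim (BP.not-¬ refl (trans (sym (<ᶠ-asym i k))
                                   (cong₂ _∧_ (<ᶠ-trans i j k i<j j<k) k<i)))

  between : {i j k : Fin n} → i ≢ j → j ≢ k → (i <ᶠ k) ≡ true →
            (i <ᶠ j) xor (k <ᶠ j) ≡ (i <ᶠ j) ∧ (j <ᶠ k)
  between {i} {j} {k} i≢j j≢k i<k rewrite <ᶠ-flip j≢k with i <ᶠ j in i<j | j <ᶠ k in j<k
  ... | true | true = refl
  ... | true | false = refl
  ... | false | true = refl
  ... | false | false = no-cycle i k j i<k (trans (<ᶠ-flip j≢k) (cong not j<k))
                                            (trans (<ᶠ-flip i≢j) (cong not i<j))

  extremal-not-between : {i j k : Fin n} → i ≢ j → j ≢ k → (i <ᶠ k) ≡ true →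
    ((j <ᶠ i) ∧ (j <ᶠ k)) xor ((i <ᶠ j) ∧ (k <ᶠ j)) ≡ not ((i <ᶠ j) ∧ (j <ᶠ k))
  extremal-not-between {i} {j} {k} i≢j j≢k i<k rewrite <ᶠ-flip i≢j | <ᶠ-flip j≢k
    with i <ᶠ j in i<j | j <ᶠ k in j<k
  ... | true | true = refl
  ... | true | false = refl
  ... | false | true = refl
  ... | false | false = no-cycle i k j i<k (trans (<ᶠ-flip j≢k) (cong not j<k))
                                            (trans (<ᶠ-flip i≢j) (cong not i<j))

  <ᶠ-three-ways : {i j k : Fin n} → i ≢ j → i ≢ k → j ≢ k →
    (i <ᶠ j) ≡ ((i <ᶠ j) ∧ (j <ᶠ k)) xor (((i <ᶠ k) ∧ (k <ᶠ j)) xor ((k <ᶠ i) ∧ (i <ᶠ j)))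
  <ᶠ-three-ways {i} {j} {k} i≢j i≢k j≢k rewrite <ᶠ-flip j≢k | <ᶠ-flip i≢k
    with i <ᶠ j in i<j | j <ᶠ k in j<k | i <ᶠ k in i<k
  ... | true | true | true = refl
  ... | true | true | false = no-cycle i j k i<j j<k (trans (<ᶠ-flip i≢k) (cong not i<k))
  ... | true | false | true = refl
  ... | true | false | false = refl
  ... | false | true | true = refl
  ... | false | true | false = refl
  ... | false | false | true = no-cycle i k j i<k (trans (<ᶠ-flip j≢k) (cong not j<k))
                                                  (trans (<ᶠ-flip i≢j) (cong not i<j))
  ... | false | false | false = refl

  -- Summing over ordered pairs i < j, every unordered triangle {p < q < r} is met three times.
  sum-over-triangles : (f : Fin n → Fin n → Fin n → Bool) →
    (∀ i j k → i ≡ j ⊎ i ≡ k ⊎ j ≡ k → f i j k ≡ false) →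
    sum³ (λ i j k → (i <ᶠ j) ∧ f i j k) ≡
    sum³ (λ p q r → ((p <ᶠ q) ∧ (q <ᶠ r)) ∧ (f p q r xor (f p r q xor f q r p)))
  sum-over-triangles f degenerate = begin
    sum³ (λ i j k → (i <ᶠ j) ∧ f i j k)
      ≡⟨ sum³-cong split ⟩
    sum³ (λ i j k → (M i j k ∧ f i j k) xor ((M i k j ∧ f i j k) xor (M k i j ∧ f i j k)))
      ≡⟨ trans (sum³-xor (λ i j k → M i j k ∧ f i j k) (λ i j k → (M i k j ∧ f i j k) xor (M k i j ∧ f i j k)))
               (cong (sum³ (λ i j k → M i j k ∧ f i j k) xor_)
                     (sum³-xor (λ i j k → M i k j ∧ f i j k) (λ i j k → M k i j ∧ f i j k))) ⟩
    sum³ (λ i j k → M i j k ∧ f i j k) xor (sum³ (λ i j k → M i k j ∧ f i j k) xor sum³ (λ i j k → M k i j ∧ f i j k))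
      ≡⟨ cong (sum³ (λ i j k → M i j k ∧ f i j k) xor_)
              (cong₂ _xor_ (sum³-swap₂₃ (λ i j k → M i k j ∧ f i j k)) (sum³-rotate (λ i j k → M k i j ∧ f i j k))) ⟨
    sum³ (λ p q r → M p q r ∧ f p q r) xor (sum³ (λ p q r → M p q r ∧ f p r q) xor sum³ (λ p q r → M p q r ∧ f q r p))
      ≡⟨ trans (sum³-xor (λ p q r → M p q r ∧ f p q r) (λ p q r → (M p q r ∧ f p r q) xor (M p q r ∧ f q r p)))
               (cong (sum³ (λ p q r → M p q r ∧ f p q r) xor_)
                     (sum³-xor (λ p q r → M p q r ∧ f p r q) (λ p q r → M p q r ∧ f q r p))) ⟨
    sum³ (λ p q r → (M p q r ∧ f p q r) xor ((M p q r ∧ f p r q) xor (M p q r ∧ f q r p)))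
      ≡⟨ sum³-cong (λ p q r → trans (BP.∧-distribˡ-xor (M p q r) (f p q r) _)
                                    (cong (M p q r ∧ f p q r xor_) (BP.∧-distribˡ-xor (M p q r) (f p r q) (f q r p)))) ⟨
    sum³ (λ p q r → M p q r ∧ (f p q r xor (f p r q xor f q r p))) ∎
    where
    open ≡-Reasoning
    M : Fin n → Fin n → Fin n → Bool
    M i j k = (i <ᶠ j) ∧ (j <ᶠ k)
    vanishing : ∀ x a b c {f} → f ≡ false → x ∧ f ≡ (a ∧ f) xor ((b ∧ f) xor (c ∧ f))
    vanishing x a b c refl rewrite BP.∧-zeroʳ x | BP.∧-zeroʳ a | BP.∧-zeroʳ b | BP.∧-zeroʳ c = refl
    split : ∀ i j k → (i <ᶠ j) ∧ f i j k ≡ (M i j k ∧ f i j k) xor ((M i k j ∧ f i j k) xor (M k i j ∧ f i j k))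
    split i j k with i Fin.≟ j | i Fin.≟ k | j Fin.≟ k
    ... | yes i≡j | _ | _ = vanishing (i <ᶠ j) (M i j k) (M i k j) (M k i j) (degenerate i j k (inj₁ i≡j))
    ... | no _ | yes i≡k | _ = vanishing (i <ᶠ j) (M i j k) (M i k j) (M k i j) (degenerate i j k (inj₂ (inj₁ i≡k)))
    ... | no _ | no _ | yes j≡k = vanishing (i <ᶠ j) (M i j k) (M i k j) (M k i j) (degenerate i j k (inj₂ (inj₂ j≡k)))
    ... | no i≢j | no i≢k | no j≢k = trans (cong (_∧ f i j k) (<ᶠ-three-ways i≢j i≢k j≢k))
      (trans (BP.∧-distribʳ-xor (f i j k) (M i j k) _)
             (cong (M i j k ∧ f i j k xor_) (BP.∧-distribʳ-xor (f i j k) (M i k j) (M k i j))))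

-- Reduced certificates

module _ (G : Graph) where

  adj-≢ : {i j : Fin (n G)} → adj G i j ≡ true → i ≢ j
  adj-≢ {i} h refl = BP.not-¬ refl (trans (sym (irrefl G i)) h)

  isEdgeIdx-irrefl : (i : Fin (n G)) → isEdgeIdx G i i ≡ false
  isEdgeIdx-irrefl i = cong (_∧ adj G i i) (<ᶠ-irrefl i)

  -- What is left of a certificate of degree one: B i j k is the coefficient of x_k in the multiplier
  -- of the edge polynomial of v_i v_j, `pair` and `triple` say that x_a x_b² and x_a x_b x_c have
  -- coefficient 0, and `total` that the constant term is 1 once the constants of the vertex
  -- multipliers are eliminated with the equations for x_a³.
  record ReducedCertificate : Set where
    field
      B : Fin (n G) → Fin (n G) → Fin (n G) → Bool
      B-sym : ∀ i j k → B i j k ≡ B j i k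
      B-nonedge : ∀ i j k → adj G i j ≡ false → B i j k ≡ false
      total : sum (λ a → sum λ j → B a j a) ≡ true
      pair : ∀ {a b} → a ≢ b → sum (λ j → B b j a) xor B a b b ≡ false
      triple : ∀ {a b c} → a ≢ b → a ≢ c → b ≢ c → B a b c xor (B b c a xor B a c b) ≡ false

  isEdgeIdx-nonadjacent : {i j : Fin (n G)} → adj G i j ≡ false → isEdgeIdx G i j ≡ false
  isEdgeIdx-nonadjacent {i} {j} eq = trans (cong ((i <ᶠ j) ∧_) eq) (BP.∧-zeroʳ (i <ᶠ j))

  isEdgeIdx-adjacent : {i j : Fin (n G)} → adj G i j ≡ true → isEdgeIdx G i j ≡ (i <ᶠ j)
  isEdgeIdx-adjacent {i} {j} eq = trans (cong ((i <ᶠ j) ∧_) eq) (BP.∧-identityʳ (i <ᶠ j))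

module FromCertificate (G : Graph)
  (αV : Fin (n G) → Poly (n G)) (αE : Fin (n G) → Fin (n G) → Poly (n G))
  (αV-deg : ∀ i → DegLe (αV i) 1) (αE-deg : ∀ i j → isEdgeIdx G i j ≡ true → DegLe (αE i j) 1)
  (combo≈1 : combo G αV αE ≈P 1P) where

  cV : Fin (n G) → Bool
  cV i = coeff (αV i) 0M

  private
    open AffineCombination G αV αE cV (λ i k → coeff (αV i) (e k)) (λ i j → coeff (αE i j) 0M)
           (λ i j k → coeff (αE i j) (e k)) (λ i → affine-expansion (αV i) (αV-deg i))
           (λ i j h → affine-expansion (αE i j) (αE-deg i j h))

    edgeWeight-irrefl : ∀ i k → edgeWeight i i k ≡ false
    edgeWeight-irrefl i k = cong (_∧ coeff (αE i i) (e k)) (isEdgeIdx-irrefl G i)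

    cubic-vanishes : ∀ a b c → cubicPart cV edgeWeight (cubic a b c) ≡ false
    cubic-vanishes a b c = trans (sym (coeff-combo-cubic (cubic a b c) (mdeg-cubic a b c)))
      (trans (combo≈1 (cubic a b c)) (cong (_xor false) (≟M-degrees (cubic a b c) 0M (mdeg-cubic a b c) (mdeg-0M {n G}) λ ())))

    B : Fin (n G) → Fin (n G) → Fin (n G) → Bool
    B = sym₁₂ edgeWeight

    B-nonedge : ∀ i j k → adj G i j ≡ false → B i j k ≡ false
    B-nonedge i j k eq = cong₂ _xor_ (cong (_∧ coeff (αE i j) (e k)) (isEdgeIdx-nonadjacent G eq))
                                      (cong (_∧ coeff (αE j i) (e k)) (isEdgeIdx-nonadjacent G (trans (Graph.sym G j i) eq)))

    constant-vanishes : ∀ a → sum (λ j → B a j a) ≡ cV a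
    constant-vanishes a = sym (xor≡false⇒≡ (trans (sym (cubicPart-aaa cV edgeWeight edgeWeight-irrefl a)) (cubic-vanishes a a a)))

  reduced : ReducedCertificate G
  reduced = record
    { B = B
    ; B-sym = λ i j k → BP.xor-comm (edgeWeight i j k) (edgeWeight j i k)
    ; B-nonedge = B-nonedge
    ; total = trans (sum-cong-≗ constant-vanishes)
        (trans (sym coeff-combo-0) (trans (combo≈1 0M) (cong (_xor false) (≟M-refl (0M {n G})))))
    ; pair = λ {a} {b} a≢b → trans (sym (cubicPart-abb cV edgeWeight edgeWeight-irrefl a≢b)) (cubic-vanishes a b b)
    ; triple = λ {a} {b} {c} a≢b a≢c b≢c →
        trans (sym (cubicPart-abc cV edgeWeight edgeWeight-irrefl a≢b a≢c b≢c)) (cubic-vanishes a b c)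
    }

no-certificate₀ : (G : Graph) → ¬ HasCert G 0
no-certificate₀ G (αV , αE , αV-deg , αE-deg , combo≈1) =
  BP.not-¬ (trans (sym no-edge-terms) total) refl
  where
  deg≤0⇒deg≤1 : ∀ {p : Poly (n G)} → DegLe p 0 → DegLe p 1
  deg≤0⇒deg≤1 deg m c = ℕP.≤-trans (deg m c) z≤n
  open FromCertificate G αV αE (λ i → deg≤0⇒deg≤1 {αV i} (αV-deg i))
                               (λ i j h → deg≤0⇒deg≤1 {αE i j} (αE-deg i j h)) combo≈1
  open ReducedCertificate reduced
  edge-terms-vanish : ∀ i j k → isEdgeIdx G i j ∧ coeff (αE i j) (e k) ≡ false
  edge-terms-vanish i j k with isEdgeIdx G i j in edge
  ... | false = refl
  ... | true with coeff (αE i j) (e k) in c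
  ...   | false = refl
  ...   | true with subst (_≤ 0) (mdeg-e k) (αE-deg i j edge (e k) c)
  ...     | ()
  no-edge-terms : sum (λ a → sum λ j → B a j a) ≡ false
  no-edge-terms = sum-zero λ a → sum-zero λ j → cong₂ _xor_ (edge-terms-vanish a j a) (edge-terms-vanish j a a)

module ToCertificate (G : Graph) (R : ReducedCertificate G) where

  open ReducedCertificate R

  private
    cV : Fin (n G) → Bool
    cV a = sum λ j → B a j a

    αV : Fin (n G) → Poly (n G)
    αV a = affine (cV a) (λ _ → false)

    αE : Fin (n G) → Fin (n G) → Poly (n G)
    αE i j = affine false (B i j)

    open AffineCombination G αV αE cV (λ _ _ → false) (λ _ _ → false) B (λ _ _ → refl) (λ _ _ _ _ → refl)

    edgeWeight-irrefl : ∀ i k → edgeWeight i i k ≡ false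
    edgeWeight-irrefl i k = cong (_∧ B i i k) (isEdgeIdx-irrefl G i)

    sym₁₂-edgeWeight : ∀ i j k → sym₁₂ edgeWeight i j k ≡ B i j k
    sym₁₂-edgeWeight i j k = by-adjacency (adj G i j) refl
      where
      by-adjacency : ∀ b → adj G i j ≡ b → sym₁₂ edgeWeight i j k ≡ B i j k
      by-adjacency false eq =
        trans (cong₂ _xor_ (cong (_∧ B i j k) (isEdgeIdx-nonadjacent G eq))
                           (cong (_∧ B j i k) (isEdgeIdx-nonadjacent G (trans (Graph.sym G j i) eq))))
              (sym (B-nonedge i j k eq))
      by-adjacency true eq = begin
        (isEdgeIdx G i j ∧ B i j k) xor (isEdgeIdx G j i ∧ B j i k)
          ≡⟨ cong₂ _xor_ (cong (_∧ B i j k) (isEdgeIdx-adjacent G eq))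
                         (cong₂ _∧_ (isEdgeIdx-adjacent G (trans (Graph.sym G j i) eq)) (B-sym j i k)) ⟩
        ((i <ᶠ j) ∧ B i j k) xor ((j <ᶠ i) ∧ B i j k)
          ≡⟨ BP.∧-distribʳ-xor (B i j k) (i <ᶠ j) (j <ᶠ i) ⟨
        ((i <ᶠ j) xor (j <ᶠ i)) ∧ B i j k
          ≡⟨ cong (_∧ B i j k) (<ᶠ-connex (adj-≢ G eq)) ⟩
        B i j k ∎
        where open ≡-Reasoning

    pair-vanishes : ∀ {a b} → a ≢ b → cubicPart cV edgeWeight (cubic a b b) ≡ false
    pair-vanishes {a} {b} a≢b = trans (cubicPart-abb cV edgeWeight edgeWeight-irrefl a≢b)
      (trans (cong₂ _xor_ (sum-cong-≗ λ j → sym₁₂-edgeWeight b j a) (sym₁₂-edgeWeight a b b)) (pair a≢b))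

    cubic-vanishes : ∀ a b c → cubicPart cV edgeWeight (cubic a b c) ≡ false
    cubic-vanishes a b c with a Fin.≟ b | b Fin.≟ c | a Fin.≟ c
    ... | yes refl | yes refl | _ = trans (cubicPart-aaa cV edgeWeight edgeWeight-irrefl a)
      (trans (cong (cV a xor_) (sum-cong-≗ λ j → sym₁₂-edgeWeight a j a)) (BP.xor-same (cV a)))
    ... | yes refl | no b≢c | _ =
      trans (cong (cubicPart cV edgeWeight) (trans (cubic-swap₂₃ a a c) (cubic-swap₁₂ a c a))) (pair-vanishes (b≢c ∘ sym))
    ... | no a≢b | yes refl | _ = pair-vanishes a≢b
    ... | no a≢b | no _ | yes refl = trans (cong (cubicPart cV edgeWeight) (cubic-swap₁₂ a b a)) (pair-vanishes (a≢b ∘ sym))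
    ... | no a≢b | no b≢c | no a≢c = trans (cubicPart-abc cV edgeWeight edgeWeight-irrefl a≢b a≢c b≢c)
      (trans (cong₂ _xor_ (sym₁₂-edgeWeight a b c) (cong₂ _xor_ (sym₁₂-edgeWeight b c a) (sym₁₂-edgeWeight a c b)))
             (triple a≢b a≢c b≢c))

    cubicPart-vanishes : ∀ m → cubicPart cV edgeWeight m ≡ false
    cubicPart-vanishes m with mdeg m ℕ.≟ 3
    ... | no ≢3 = cubicPart-vanish cV edgeWeight m ≢3
    ... | yes ≡3 with mdeg≡3⇒cubic m ≡3
    ...   | a , b , c , refl = cubic-vanishes a b c

  certificate : HasCert G 1
  certificate = αV , αE , (λ a → affine-deg≤1 (cV a) (λ _ → false)) , (λ i j _ → affine-deg≤1 false (B i j)) ,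
    λ m → trans (coeff-combo-reduced (λ _ _ → refl) (λ _ _ → refl) m)
                (cong₂ _xor_ (trans (cong ((m ≟M 0M) ∧_) total) (BP.∧-identityʳ (m ≟M 0M))) (cubicPart-vanishes m))

N≡1⇔reduced : (G : Graph) → N≡ G 1 ⇔ ReducedCertificate G
N≡1⇔reduced G = mk⇔
  (λ { ((αV , αE , αV-deg , αE-deg , combo≈1) , _) → FromCertificate.reduced G αV αE αV-deg αE-deg combo≈1 })
  (λ R → ToCertificate.certificate G R , λ { zero _ → no-certificate₀ G ; (suc _) (s≤s ()) })

module Paths (G : Graph) (C : Fin (n G) × Fin (n G) × Fin (n G) → Bool) where

  path : Fin (n G) → Fin (n G) → Fin (n G) → Bool
  path i j k = isPath G (i , j , k) ∧ C (i , j , k)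

  path↔ : Fin (n G) → Fin (n G) → Fin (n G) → Bool
  path↔ i j k = path i j k xor path k j i

  extremal : Fin (n G) → Fin (n G) → Fin (n G) → Bool
  extremal i j k = ((j <ᶠ i) ∧ (j <ᶠ k)) xor ((i <ᶠ j) ∧ (k <ᶠ j))

  path-spec : ∀ {i j k} → path i j k ≡ true → (i <ᶠ k) ≡ true × adj G i j ≡ true × adj G j k ≡ true
  path-spec h with ∧-true⇒ h
  ... | is-path , _ with ∧-true⇒ is-path
  ...   | i<k , adjacent with ∧-true⇒ adjacent
  ...     | i~j , j~k = i<k , i~j , j~k

  path-unordered : ∀ i j k → (i <ᶠ k) ≡ false → path i j k ≡ false
  path-unordered i j k eq = cong (λ b → (b ∧ adj G i j ∧ adj G j k) ∧ C (i , j , k)) eq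

  path-nonadjacent₁ : ∀ i j k → adj G i j ≡ false → path i j k ≡ false
  path-nonadjacent₁ i j k eq = trans (cong (λ b → ((i <ᶠ k) ∧ b ∧ adj G j k) ∧ C (i , j , k)) eq)
                                     (cong (_∧ C (i , j , k)) (BP.∧-zeroʳ (i <ᶠ k)))

  path-nonadjacent₂ : ∀ i j k → adj G j k ≡ false → path i j k ≡ false
  path-nonadjacent₂ i j k eq = trans (cong (λ b → ((i <ᶠ k) ∧ adj G i j ∧ b) ∧ C (i , j , k)) eq)
    (cong (_∧ C (i , j , k)) (trans (cong ((i <ᶠ k) ∧_) (BP.∧-zeroʳ (adj G i j))) (BP.∧-zeroʳ (i <ᶠ k))))

  condition₃-sum : ∀ a b → sum³ (λ i j k → path i j k ∧ sameEdge i k a b) ≡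
                           sum (λ j → path a j b) xor sum (λ j → path b j a)
  condition₃-sum a b = trans (sum³-cong λ i j k → BP.∧-distribˡ-xor (path i j k) _ _)
    (trans (sum³-xor (λ i j k → path i j k ∧ (δ i a ∧ δ k b)) (λ i j k → path i j k ∧ (δ i b ∧ δ k a)))
           (cong₂ _xor_ (∑³-δ₁₃ path a b) (∑³-δ₁₃ path b a)))

  condition₁-sum : ∀ a b → sum³ (λ i j k → path i j k ∧ (sameEdge i j a b xor sameEdge j k a b)) ≡
                           sum (λ x → path↔ a b x xor path↔ b a x)
  condition₁-sum a b = begin
    sum³ (λ i j k → path i j k ∧ (sameEdge i j a b xor sameEdge j k a b))
      ≡⟨ sum³-cong (λ i j k → trans (BP.∧-distribˡ-xor (path i j k) _ _)
                                    (cong₂ _xor_ (BP.∧-distribˡ-xor (path i j k) _ _) (BP.∧-distribˡ-xor (path i j k) _ _))) ⟩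
    sum³ (λ i j k → (path i j k ∧ (δ i a ∧ δ j b) xor path i j k ∧ (δ i b ∧ δ j a)) xor
                    (path i j k ∧ (δ j a ∧ δ k b) xor path i j k ∧ (δ j b ∧ δ k a)))
      ≡⟨ trans (sum³-xor (λ i j k → path i j k ∧ (δ i a ∧ δ j b) xor path i j k ∧ (δ i b ∧ δ j a))
                         (λ i j k → path i j k ∧ (δ j a ∧ δ k b) xor path i j k ∧ (δ j b ∧ δ k a)))
               (cong₂ _xor_ (sum³-xor (λ i j k → path i j k ∧ (δ i a ∧ δ j b)) (λ i j k → path i j k ∧ (δ i b ∧ δ j a)))
                            (sum³-xor (λ i j k → path i j k ∧ (δ j a ∧ δ k b)) (λ i j k → path i j k ∧ (δ j b ∧ δ k a)))) ⟩
    (sum³ (λ i j k → path i j k ∧ (δ i a ∧ δ j b)) xor sum³ (λ i j k → path i j k ∧ (δ i b ∧ δ j a))) xor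
    (sum³ (λ i j k → path i j k ∧ (δ j a ∧ δ k b)) xor sum³ (λ i j k → path i j k ∧ (δ j b ∧ δ k a)))
      ≡⟨ cong₂ _xor_ (cong₂ _xor_ (∑³-δ₁₂ path a b) (∑³-δ₁₂ path b a)) (cong₂ _xor_ (∑³-δ₂₃ path a b) (∑³-δ₂₃ path b a)) ⟩
    (sum (path a b) xor sum (path b a)) xor (sum (λ x → path x a b) xor sum (λ x → path x b a))
      ≡⟨ solve 4 (λ P Q R S → (P ⊕ Q) ⊕ (R ⊕ S) ⊜ (P ⊕ S) ⊕ (Q ⊕ R)) refl
               (sum (path a b)) (sum (path b a)) (sum (λ x → path x a b)) (sum (λ x → path x b a)) ⟩
    (sum (path a b) xor sum (λ x → path x b a)) xor (sum (path b a) xor sum (λ x → path x a b))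
      ≡⟨ cong₂ _xor_ (∑-distrib-+ (path a b) (λ x → path x b a)) (∑-distrib-+ (path b a) (λ x → path x a b)) ⟨
    sum (path↔ a b) xor sum (path↔ b a)
      ≡⟨ ∑-distrib-+ (path↔ a b) (path↔ b a) ⟨
    sum (λ x → path↔ a b x xor path↔ b a x) ∎
    where open ≡-Reasoning

  path-distinct : ∀ {i j k} → path i j k ≡ true → i ≢ j × j ≢ k
  path-distinct h with path-spec h
  ... | _ , i~j , j~k = adj-≢ G i~j , adj-≢ G j~k

  middle-paths : sum³ (λ a b j → (a <ᶠ b) ∧ path↔ a b j) ≡ sum³ (λ i j k → path i j k ∧ ((i <ᶠ j) ∧ (j <ᶠ k)))
  middle-paths = begin
    sum³ (λ a b j → (a <ᶠ b) ∧ path↔ a b j)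
      ≡⟨ sum³-cong (λ a b j → BP.∧-distribˡ-xor (a <ᶠ b) (path a b j) (path j b a)) ⟩
    sum³ (λ a b j → ((a <ᶠ b) ∧ path a b j) xor ((a <ᶠ b) ∧ path j b a))
      ≡⟨ sum³-xor (λ a b j → (a <ᶠ b) ∧ path a b j) (λ a b j → (a <ᶠ b) ∧ path j b a) ⟩
    sum³ (λ i j k → (i <ᶠ j) ∧ path i j k) xor sum³ (λ a b j → (a <ᶠ b) ∧ path j b a)
      ≡⟨ cong (sum³ (λ i j k → (i <ᶠ j) ∧ path i j k) xor_) (sum³-reverse (λ i j k → (k <ᶠ j) ∧ path i j k)) ⟩
    sum³ (λ i j k → (i <ᶠ j) ∧ path i j k) xor sum³ (λ i j k → (k <ᶠ j) ∧ path i j k)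
      ≡⟨ sum³-xor (λ i j k → (i <ᶠ j) ∧ path i j k) (λ i j k → (k <ᶠ j) ∧ path i j k) ⟨
    sum³ (λ i j k → ((i <ᶠ j) ∧ path i j k) xor ((k <ᶠ j) ∧ path i j k))
      ≡⟨ sum³-cong (λ i j k → trans (sym (BP.∧-distribʳ-xor (path i j k) (i <ᶠ j) (k <ᶠ j)))
                                    (trans (BP.∧-comm _ (path i j k)) (∧-guard (path i j k) λ h →
                                      let i≢j , j≢k = path-distinct h in between i≢j j≢k (proj₁ (path-spec h))))) ⟩
    sum³ (λ i j k → path i j k ∧ ((i <ᶠ j) ∧ (j <ᶠ k))) ∎
    where open ≡-Reasoning

  extremal-split : sum³ (λ i j k → path i j k ∧ extremal i j k) ≡
                   sum³ path xor sum³ (λ i j k → path i j k ∧ ((i <ᶠ j) ∧ (j <ᶠ k)))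
  extremal-split = trans (sum³-cong pointwise) (sum³-xor path (λ i j k → path i j k ∧ ((i <ᶠ j) ∧ (j <ᶠ k))))
    where
    pointwise : ∀ i j k → path i j k ∧ extremal i j k ≡ path i j k xor (path i j k ∧ ((i <ᶠ j) ∧ (j <ᶠ k)))
    pointwise i j k = trans (∧-guard (path i j k) λ h → let i≢j , j≢k = path-distinct h in
                                            extremal-not-between i≢j j≢k (proj₁ (path-spec h)))
                            (∧-not (path i j k) _)
      where
      ∧-not : ∀ x y → x ∧ not y ≡ x xor (x ∧ y)
      ∧-not false y = refl
      ∧-not true false = refl
      ∧-not true true = refl

  paths-in-triangles : (∀ i k → adj G i k ≡ false → sum (λ j → path i j k) ≡ false) →
                       sum³ path ≡ sum³ (λ i j k → path i j k ∧ adj G i k)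
  paths-in-triangles no-path = begin
    sum³ path
      ≡⟨ sum³-cong (λ i j k → split (path i j k) (adj G i k)) ⟩
    sum³ (λ i j k → (path i j k ∧ not (adj G i k)) xor (path i j k ∧ adj G i k))
      ≡⟨ sum³-xor (λ i j k → path i j k ∧ not (adj G i k)) (λ i j k → path i j k ∧ adj G i k) ⟩
    sum³ (λ i j k → path i j k ∧ not (adj G i k)) xor sum³ (λ i j k → path i j k ∧ adj G i k)
      ≡⟨ cong (_xor sum³ (λ i j k → path i j k ∧ adj G i k)) outside-triangles ⟩
    sum³ (λ i j k → path i j k ∧ adj G i k) ∎
    where
    open ≡-Reasoning
    split : ∀ x y → x ≡ (x ∧ not y) xor (x ∧ y)
    split false y = refl
    split true false = refl
    split true true = refl
    outside-triangles : sum³ (λ i j k → path i j k ∧ not (adj G i k)) ≡ false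
    outside-triangles = trans (sum-cong-≗ λ i → ∑-comm (λ j k → path i j k ∧ not (adj G i k)))
      (sum-zero λ i → sum-zero λ k → trans (sym (*-distribʳ-sum (not (adj G i k)) (λ j → path i j k)))
        (by-adjacency (adj G i k) refl))
      where
      by-adjacency : ∀ {i k} b → adj G i k ≡ b → sum (λ j → path i j k) ∧ not b ≡ false
      by-adjacency true _ = BP.∧-zeroʳ _
      by-adjacency {i} {k} false eq = cong (_∧ true) (no-path i k eq)

-- From certificates to covers

module CoverOfCertificate (G : Graph) (R : ReducedCertificate G) where

  open ReducedCertificate R

  -- A path i-j-k is weighted by the coefficient of the apex j on the edge v_i v_k when that edge
  -- exists, and otherwise by the coefficient of the endpoint k on the edge v_i v_j.
  chosen : Fin (n G) × Fin (n G) × Fin (n G) → Bool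
  chosen (i , j , k) = if adj G i k then B i k j else B i j k

  open Paths G chosen

  private
    B-apex-swap : ∀ {a b c} → a ≢ b → a ≢ c → b ≢ c → adj G a c ≡ false → B a b c ≡ B b c a
    B-apex-swap {a} {b} {c} a≢b a≢c b≢c a≁c = xor≡false⇒≡ (trans
      (cong (B a b c xor_) (trans (sym (BP.xor-identityʳ (B b c a))) (cong (B b c a xor_) (sym (B-nonedge a c b a≁c)))))
      (triple a≢b a≢c b≢c))

    B-apex : ∀ {a b c} → a ≢ b → a ≢ c → b ≢ c → adj G a c ≡ false → adj G b c ≡ false → B a b c ≡ false
    B-apex a≢b a≢c b≢c a≁c b≁c = trans (B-apex-swap a≢b a≢c b≢c a≁c) (B-nonedge _ _ _ b≁c)

    path-across-nonedge : ∀ {a b} → adj G a b ≡ false → (a <ᶠ b) ≡ true → ∀ j → path a j b ≡ B a j b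
    path-across-nonedge {a} {b} a≁b a<b j rewrite a≁b | a<b with adj G a j in a~j | adj G j b in j~b
    ... | false | _ = sym (B-nonedge a j b a~j)
    ... | true | false = sym (B-apex (adj-≢ G a~j) (<ᶠ-≢ a<b) j≢b a≁b j~b)
      where
      j≢b : j ≢ b
      j≢b refl = BP.not-¬ refl (trans (sym a≁b) a~j)
    ... | true | true = refl

  paths-between-nonadjacent : ∀ {a b} → adj G a b ≡ false → sum (λ j → path a j b) ≡ false
  paths-between-nonadjacent {a} {b} a≁b = by-order (a <ᶠ b) refl
    where
    by-order : ∀ o → (a <ᶠ b) ≡ o → sum (λ j → path a j b) ≡ false
    by-order false a≮b = sum-zero λ j → path-unordered a j b a≮b
    by-order true a<b = trans (sum-cong-≗ (path-across-nonedge a≁b a<b))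
      (trans (xor≡false⇒≡ (pair (<ᶠ-≢ a<b ∘ sym))) (B-nonedge b a a (trans (Graph.sym G b a) a≁b)))

  condition₃ : ∀ a b → adj G a b ≡ false → sum (λ j → path a j b) xor sum (λ j → path b j a) ≡ false
  condition₃ a b a≁b = cong₂ _xor_ (paths-between-nonadjacent a≁b)
                                   (paths-between-nonadjacent (trans (Graph.sym G b a) a≁b))

  private
    path↔-at-edge : ∀ {a b x} → adj G a b ≡ true → a ≢ x →
                    path↔ a b x ≡ adj G b x ∧ (if adj G a x then B a x b else B b x a)
    path↔-at-edge {a} {b} {x} a~b a≢x
      rewrite Graph.sym G b a | a~b | Graph.sym G x b | Graph.sym G x a | <ᶠ-flip a≢x
      with adj G b x in b~x | adj G a x in a~x | a <ᶠ x
    ... | false | _ | true = refl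
    ... | false | _ | false = refl
    ... | true | true | true = BP.xor-identityʳ (B a x b)
    ... | true | true | false = B-sym x a b
    ... | true | false | true = trans (BP.xor-identityʳ (B a b x)) (B-apex-swap (adj-≢ G a~b) a≢x (adj-≢ G b~x) a~x)
    ... | true | false | false = B-sym x b a

    paths-through-edge : ∀ {a b} → adj G a b ≡ true → ∀ x →
      path↔ a b x xor path↔ b a x ≡ (B b x a xor B a x b) xor ((δ x a ∧ B b a a) xor (δ x b ∧ B a b b))
    paths-through-edge {a} {b} a~b x with x Fin.≟ a | x Fin.≟ b
    ... | yes refl | yes refl = ⊥-elim (adj-≢ G a~b refl)
    ... | yes refl | no _ = trans
      (cong₂ _xor_ (BP.xor-same (path x b x))
                   (cong₂ _xor_ (path-nonadjacent₂ b x x (irrefl G x)) (path-nonadjacent₁ x x b (irrefl G x))))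
      (sym (trans (cong (λ t → (B b x x xor t) xor (B b x x xor false)) (B-nonedge x x b (irrefl G x)))
                  (BP.xor-same (B b x x xor false))))
    ... | no _ | yes refl = trans
      (cong₂ _xor_ (cong₂ _xor_ (path-nonadjacent₂ a x x (irrefl G x)) (path-nonadjacent₁ x x a (irrefl G x)))
                   (BP.xor-same (path x a x)))
      (sym (trans (cong (λ t → (t xor B a x x) xor B a x x) (B-nonedge x x a (irrefl G x)))
                  (BP.xor-same (B a x x))))
    ... | no x≢a | no x≢b rewrite path↔-at-edge a~b (x≢a ∘ sym)
                                 | path↔-at-edge (trans (Graph.sym G b a) a~b) (x≢b ∘ sym)
      with adj G a x in a~x | adj G b x in b~x
    ... | true | true = trans (BP.xor-comm (B a x b) (B b x a)) (sym (BP.xor-identityʳ _))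
    ... | true | false = sym (trans (cong (λ t → (t xor B a x b) xor false) (B-nonedge b x a b~x)) (BP.xor-identityʳ _))
    ... | false | true = sym (trans (cong (λ t → (B b x a xor t) xor false) (B-nonedge a x b a~x)) (BP.xor-identityʳ _))
    ... | false | false = sym (cong₂ (λ s t → (s xor t) xor false) (B-nonedge b x a b~x) (B-nonedge a x b a~x))

  condition₁ : ∀ a b → adj G a b ≡ true → sum (λ x → path↔ a b x xor path↔ b a x) ≡ false
  condition₁ a b a~b = begin
    sum (λ x → path↔ a b x xor path↔ b a x)
      ≡⟨ sum-cong-≗ (paths-through-edge a~b) ⟩
    sum (λ x → (B b x a xor B a x b) xor ((δ x a ∧ B b a a) xor (δ x b ∧ B a b b)))
      ≡⟨ trans (∑-distrib-+ (λ x → B b x a xor B a x b) (λ x → (δ x a ∧ B b a a) xor (δ x b ∧ B a b b)))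
               (cong₂ _xor_ (∑-distrib-+ (λ x → B b x a) (λ x → B a x b))
                            (trans (∑-distrib-+ (λ x → δ x a ∧ B b a a) (λ x → δ x b ∧ B a b b))
                                   (cong₂ _xor_ (∑-δ a (λ _ → B b a a)) (∑-δ b (λ _ → B a b b))))) ⟩
    (sum (λ x → B b x a) xor sum (λ x → B a x b)) xor (B b a a xor B a b b)
      ≡⟨ solve 4 (λ P Q R S → (P ⊕ Q) ⊕ (R ⊕ S) ⊜ (P ⊕ S) ⊕ (Q ⊕ R)) refl
               (sum (λ x → B b x a)) (sum (λ x → B a x b)) (B b a a) (B a b b) ⟩
    (sum (λ x → B b x a) xor B a b b) xor (sum (λ x → B a x b) xor B b a a)
      ≡⟨ cong₂ _xor_ (pair a≢b) (pair (a≢b ∘ sym)) ⟩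
    false ∎
    where
    open ≡-Reasoning
    a≢b = adj-≢ G a~b

  private
    triangle : Fin (n G) → Fin (n G) → Fin (n G) → Bool
    triangle i j k = adj G i j ∧ (adj G j k ∧ (adj G i k ∧ B i j k))

    triangle-degenerate : ∀ i j k → i ≡ j ⊎ i ≡ k ⊎ j ≡ k → triangle i j k ≡ false
    triangle-degenerate i .i k (inj₁ refl) rewrite irrefl G i = refl
    triangle-degenerate i j .i (inj₂ (inj₁ refl)) rewrite irrefl G i =
      trans (cong (adj G i j ∧_) (BP.∧-zeroʳ (adj G j i))) (BP.∧-zeroʳ (adj G i j))
    triangle-degenerate i j .j (inj₂ (inj₂ refl)) rewrite irrefl G j = BP.∧-zeroʳ (adj G i j)

    triangle-cancel : ∀ p q r → triangle p q r xor (triangle p r q xor triangle q r p) ≡ false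
    triangle-cancel p q r rewrite Graph.sym G r q | Graph.sym G r p | Graph.sym G q p
      with adj G p q in p~q | adj G q r in q~r | adj G p r in p~r
    ... | true | true | true = trans (cong (B p q r xor_) (BP.xor-comm (B p r q) (B q r p)))
                                     (triple (adj-≢ G p~q) (adj-≢ G p~r) (adj-≢ G q~r))
    ... | true | true | false = refl
    ... | true | false | true = refl
    ... | true | false | false = refl
    ... | false | true | true = refl
    ... | false | true | false = refl
    ... | false | false | true = refl
    ... | false | false | false = refl

    triangles-vanish : sum³ (λ i j k → (i <ᶠ j) ∧ triangle i j k) ≡ false
    triangles-vanish = trans (sum-over-triangles triangle triangle-degenerate)
      (sum³-zero λ p q r → trans (cong (((p <ᶠ q) ∧ (q <ᶠ r)) ∧_) (triangle-cancel p q r)) (BP.∧-zeroʳ _))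

    apex-coefficient : ∀ {a b} → adj G a b ≡ true → ∀ j →
                       B b j a ≡ path↔ a b j xor (triangle a b j xor (δ j a ∧ B b a a))
    apex-coefficient {a} {b} a~b j with j Fin.≟ a
    ... | yes refl = sym (cong₂ _xor_ (BP.xor-same (path j b j))
                                      (cong (_xor B b j j) (triangle-degenerate j b j (inj₂ (inj₁ refl)))))
    ... | no j≢a rewrite path↔-at-edge a~b (j≢a ∘ sym) | a~b with adj G b j in b~j | adj G a j in a~j
    ...   | true | true = trans
      (xor≡false⇒≡ (trans (solve 3 (λ x y z → y ⊕ (z ⊕ x) ⊜ x ⊕ (y ⊕ z)) refl (B a b j) (B b j a) (B a j b))
                          (triple (adj-≢ G a~b) (j≢a ∘ sym) (adj-≢ G b~j))))
      (cong (B a j b xor_) (sym (BP.xor-identityʳ (B a b j))))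
    ...   | true | false = sym (BP.xor-identityʳ (B b j a))
    ...   | false | _ = B-nonedge b j a b~j

    order-split : sum (λ a → sum λ b → B a b a) ≡ sum (λ a → sum λ b → (a <ᶠ b) ∧ (B a b a xor B a b b))
    order-split = begin
      sum (λ a → sum λ b → B a b a)
        ≡⟨ sum-cong-≗ (λ a → sum-cong-≗ λ b → by-order a b) ⟩
      sum (λ a → sum λ b → ((a <ᶠ b) ∧ B a b a) xor ((b <ᶠ a) ∧ B a b a))
        ≡⟨ sum-cong-≗ (λ a → ∑-distrib-+ (λ b → (a <ᶠ b) ∧ B a b a) (λ b → (b <ᶠ a) ∧ B a b a)) ⟩
      sum (λ a → sum (λ b → (a <ᶠ b) ∧ B a b a) xor sum (λ b → (b <ᶠ a) ∧ B a b a))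
        ≡⟨ ∑-distrib-+ (λ a → sum λ b → (a <ᶠ b) ∧ B a b a) (λ a → sum λ b → (b <ᶠ a) ∧ B a b a) ⟩
      sum (λ a → sum λ b → (a <ᶠ b) ∧ B a b a) xor sum (λ a → sum λ b → (b <ᶠ a) ∧ B a b a)
        ≡⟨ cong (sum (λ a → sum λ b → (a <ᶠ b) ∧ B a b a) xor_)
                (trans (∑-comm (λ a b → (b <ᶠ a) ∧ B a b a))
                       (sum-cong-≗ λ a → sum-cong-≗ λ b → cong ((a <ᶠ b) ∧_) (B-sym b a b))) ⟩
      sum (λ a → sum λ b → (a <ᶠ b) ∧ B a b a) xor sum (λ a → sum λ b → (a <ᶠ b) ∧ B a b b)
        ≡⟨ ∑-distrib-+ (λ a → sum λ b → (a <ᶠ b) ∧ B a b a) (λ a → sum λ b → (a <ᶠ b) ∧ B a b b) ⟨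
      sum (λ a → sum (λ b → (a <ᶠ b) ∧ B a b a) xor sum (λ b → (a <ᶠ b) ∧ B a b b))
        ≡⟨ sum-cong-≗ (λ a → ∑-distrib-+ (λ b → (a <ᶠ b) ∧ B a b a) (λ b → (a <ᶠ b) ∧ B a b b)) ⟨
      sum (λ a → sum λ b → ((a <ᶠ b) ∧ B a b a) xor ((a <ᶠ b) ∧ B a b b))
        ≡⟨ sum-cong-≗ (λ a → sum-cong-≗ λ b → BP.∧-distribˡ-xor (a <ᶠ b) (B a b a) (B a b b)) ⟨
      sum (λ a → sum λ b → (a <ᶠ b) ∧ (B a b a xor B a b b)) ∎
      where
      open ≡-Reasoning
      by-order : ∀ a b → B a b a ≡ ((a <ᶠ b) ∧ B a b a) xor ((b <ᶠ a) ∧ B a b a)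
      by-order a b with a Fin.≟ b
      ... | yes refl rewrite B-nonedge a a a (irrefl G a) | BP.∧-zeroʳ (a <ᶠ a) = refl
      ... | no a≢b = sym (trans (sym (BP.∧-distribʳ-xor (B a b a) (a <ᶠ b) (b <ᶠ a)))
                                (cong (_∧ B a b a) (<ᶠ-connex a≢b)))

    edge-coefficients : ∀ a b → (a <ᶠ b) ∧ (B a b a xor B a b b) ≡
                                (a <ᶠ b) ∧ (sum (path↔ a b) xor sum (triangle a b))
    edge-coefficients a b = ∧-guard (a <ᶠ b) λ a<b → by-adjacency (adj G a b) refl (<ᶠ-≢ a<b)
      where
      by-adjacency : ∀ u → adj G a b ≡ u → a ≢ b → B a b a xor B a b b ≡ sum (path↔ a b) xor sum (triangle a b)
      by-adjacency false a≁b _ = trans (cong₂ _xor_ (B-nonedge a b a a≁b) (B-nonedge a b b a≁b)) (sym (cong₂ _xor_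
        (sum-zero λ j → cong₂ _xor_ (path-nonadjacent₁ a b j a≁b) (path-nonadjacent₂ j b a (trans (Graph.sym G b a) a≁b)))
        (sum-zero λ j → cong (_∧ (adj G b j ∧ (adj G a j ∧ B a b j))) a≁b)))
      by-adjacency true a~b a≢b = begin
        B a b a xor B a b b
          ≡⟨ cong₂ _xor_ (B-sym a b a) (sym (xor≡false⇒≡ (pair a≢b))) ⟩
        B b a a xor sum (λ j → B b j a)
          ≡⟨ cong (B b a a xor_) (sum-cong-≗ (apex-coefficient a~b)) ⟩
        B b a a xor sum (λ j → path↔ a b j xor (triangle a b j xor (δ j a ∧ B b a a)))
          ≡⟨ cong (B b a a xor_) (trans (∑-distrib-+ (path↔ a b) (λ j → triangle a b j xor (δ j a ∧ B b a a)))
                 (cong (sum (path↔ a b) xor_) (trans (∑-distrib-+ (triangle a b) (λ j → δ j a ∧ B b a a))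
                   (cong (sum (triangle a b) xor_) (∑-δ a (λ _ → B b a a)))))) ⟩
        B b a a xor (sum (path↔ a b) xor (sum (triangle a b) xor B b a a))
          ≡⟨ solve 3 (λ x y z → x ⊕ (y ⊕ (z ⊕ x)) ⊜ (x ⊕ x) ⊕ (y ⊕ z)) refl (B b a a) (sum (path↔ a b)) (sum (triangle a b)) ⟩
        (B b a a xor B b a a) xor (sum (path↔ a b) xor sum (triangle a b))
          ≡⟨ cong (_xor (sum (path↔ a b) xor sum (triangle a b))) (BP.xor-same (B b a a)) ⟩
        sum (path↔ a b) xor sum (triangle a b) ∎
        where open ≡-Reasoning

    middle-sum : sum³ (λ i j k → path i j k ∧ ((i <ᶠ j) ∧ (j <ᶠ k))) ≡ true
    middle-sum = begin
      sum³ (λ i j k → path i j k ∧ ((i <ᶠ j) ∧ (j <ᶠ k)))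
        ≡⟨ middle-paths ⟨
      sum³ (λ a b j → (a <ᶠ b) ∧ path↔ a b j)
        ≡⟨ trans (sym (BP.xor-identityʳ _)) (cong (sum³ (λ a b j → (a <ᶠ b) ∧ path↔ a b j) xor_) (sym triangles-vanish)) ⟩
      sum³ (λ a b j → (a <ᶠ b) ∧ path↔ a b j) xor sum³ (λ a b j → (a <ᶠ b) ∧ triangle a b j)
        ≡⟨ sum³-xor (λ a b j → (a <ᶠ b) ∧ path↔ a b j) (λ a b j → (a <ᶠ b) ∧ triangle a b j) ⟨
      sum³ (λ a b j → ((a <ᶠ b) ∧ path↔ a b j) xor ((a <ᶠ b) ∧ triangle a b j))
        ≡⟨ sum-cong-≗ (λ a → sum-cong-≗ λ b → trans
             (sum-cong-≗ λ j → sym (BP.∧-distribˡ-xor (a <ᶠ b) (path↔ a b j) (triangle a b j)))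
             (trans (sym (*-distribˡ-sum (a <ᶠ b) (λ j → path↔ a b j xor triangle a b j)))
                    (cong ((a <ᶠ b) ∧_) (∑-distrib-+ (path↔ a b) (triangle a b))))) ⟩
      sum (λ a → sum λ b → (a <ᶠ b) ∧ (sum (path↔ a b) xor sum (triangle a b)))
        ≡⟨ sum-cong-≗ (λ a → sum-cong-≗ λ b → edge-coefficients a b) ⟨
      sum (λ a → sum λ b → (a <ᶠ b) ∧ (B a b a xor B a b b))
        ≡⟨ order-split ⟨
      sum (λ a → sum λ b → B a b a)
        ≡⟨ total ⟩
      true ∎
      where open ≡-Reasoning

    triangle-paths-vanish : sum³ (λ i j k → path i j k ∧ adj G i k) ≡ false
    triangle-paths-vanish = trans (sum³-cong pointwise)
      (trans (sum³-swap₂₃ (λ i j k → (i <ᶠ j) ∧ triangle i j k)) triangles-vanish)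
      where
      pointwise : ∀ i j k → path i j k ∧ adj G i k ≡ (i <ᶠ k) ∧ triangle i k j
      pointwise i j k rewrite Graph.sym G k j with adj G i k | i <ᶠ k | adj G i j | adj G j k
      ... | false | _ | _ | _ = trans (BP.∧-zeroʳ _) (sym (BP.∧-zeroʳ _))
      ... | true | true | true | true = BP.∧-identityʳ (B i k j)
      ... | true | true | true | false = refl
      ... | true | true | false | true = refl
      ... | true | true | false | false = refl
      ... | true | false | _ | _ = refl

  condition₂ : sum³ (λ i j k → path i j k ∧ extremal i j k) ≡ true
  condition₂ = trans extremal-split (cong₂ _xor_
    (trans (paths-in-triangles λ i k → paths-between-nonadjacent) triangle-paths-vanish) middle-sum)

  covered : CoveredByLength2Paths G
  covered = chosen ,
    (λ a b a~b → parity-via-sum³ (λ i j k → path i j k ∧ (sameEdge i j a b xor sameEdge j k a b))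
                                 (trans (condition₁-sum a b) (condition₁ a b a~b))) ,
    parity-via-sum³ (λ i j k → path i j k ∧ extremal i j k) condition₂ ,
    (λ a b a≁b → parity-via-sum³ (λ i j k → path i j k ∧ sameEdge i k a b)
                                 (trans (condition₃-sum a b) (condition₃ a b a≁b)))

-- From covers to certificates

module CertificateOfCover (G : Graph) (C : Fin (n G) × Fin (n G) × Fin (n G) → Bool)
  (condition₁ : ∀ a b → adj G a b ≡ true → sum (λ x → Paths.path↔ G C a b x xor Paths.path↔ G C b a x) ≡ false)
  (condition₂ : sum³ (λ i j k → Paths.path G C i j k ∧ Paths.extremal G C i j k) ≡ true)
  (condition₃ : ∀ a b → adj G a b ≡ false → sum (λ j → Paths.path G C a j b) xor sum (λ j → Paths.path G C b j a) ≡ false)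
  where

  open Paths G C

  -- the paths of C formed by the edge v_i v_j and an edge from one of its ends to v_k
  B′ : Fin (n G) → Fin (n G) → Fin (n G) → Bool
  B′ i j k = path↔ i j k xor path↔ j i k

  Y : Fin (n G) → Fin (n G) → Bool
  Y i j = sum λ x → B′ j x i

  -- changes only coefficients of the ends of the edge, which `triple` does not involve, so that `pair` holds
  correction : Fin (n G) → Fin (n G) → Fin (n G) → Bool
  correction i j k = adj G i j ∧ (((i <ᶠ j) ∧ (δ k i ∧ Y i j)) xor ((j <ᶠ i) ∧ (δ k j ∧ Y j i)))

  B : Fin (n G) → Fin (n G) → Fin (n G) → Bool
  B i j k = B′ i j k xor correction i j k

  private
    ∧-pull₃ : ∀ x y d z → x ∧ (y ∧ (d ∧ z)) ≡ d ∧ (x ∧ (y ∧ z))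
    ∧-pull₃ false y d z = sym (BP.∧-zeroʳ d)
    ∧-pull₃ true false d z = sym (BP.∧-zeroʳ d)
    ∧-pull₃ true true d z = refl

    path↔-reverse : ∀ x y z → path↔ x y z ≡ path↔ z y x
    path↔-reverse x y z = BP.xor-comm (path x y z) (path z y x)

    B′-loop : ∀ a b → B′ a b b ≡ false
    B′-loop a b = cong₂ _xor_ (cong₂ _xor_ (path-nonadjacent₂ a b b (irrefl G b)) (path-nonadjacent₁ b b a (irrefl G b)))
                              (BP.xor-same (path b a b))

    paths-between-nonadjacent : ∀ i k → adj G i k ≡ false → sum (λ j → path i j k) ≡ false
    paths-between-nonadjacent i k i≁k = by-order (i <ᶠ k) refl
      where
      by-order : ∀ o → (i <ᶠ k) ≡ o → sum (λ j → path i j k) ≡ false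
      by-order false i≮k = sum-zero λ j → path-unordered i j k i≮k
      by-order true i<k = trans (sym (BP.xor-identityʳ _))
        (trans (cong (sum (λ j → path i j k) xor_)
                     (sym (sum-zero λ j → path-unordered k j i (trans (sym (cong (_∧ (k <ᶠ i)) i<k)) (<ᶠ-asym i k)))))
               (condition₃ i k i≁k))

    Y-nonedge : ∀ a b → adj G a b ≡ false → Y a b ≡ false
    Y-nonedge a b a≁b = begin
      sum (λ x → (path b x a xor path a x b) xor (path x b a xor path a b x))
        ≡⟨ sum-cong-≗ (λ x → trans (cong ((path b x a xor path a x b) xor_)
               (cong₂ _xor_ (path-nonadjacent₂ x b a b≁a) (path-nonadjacent₁ a b x a≁b))) (BP.xor-identityʳ _)) ⟩
      sum (λ x → path b x a xor path a x b)
        ≡⟨ trans (∑-distrib-+ (λ x → path b x a) (λ x → path a x b)) (BP.xor-comm (sum λ x → path b x a) _) ⟩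
      sum (λ x → path a x b) xor sum (λ x → path b x a)
        ≡⟨ condition₃ a b a≁b ⟩
      false ∎
      where
      open ≡-Reasoning
      b≁a = trans (Graph.sym G b a) a≁b

    Y-edge-sym : ∀ a b → adj G a b ≡ true → Y a b ≡ Y b a
    Y-edge-sym a b a~b = xor≡false⇒≡ (trans (sym (∑-distrib-+ (λ x → B′ b x a) (λ x → B′ a x b)))
      (trans (sum-cong-≗ pointwise) (condition₁ a b a~b)))
      where
      pointwise : ∀ x → B′ b x a xor B′ a x b ≡ path↔ a b x xor path↔ b a x
      pointwise x rewrite path↔-reverse b x a | path↔-reverse x b a | path↔-reverse x a b =
        trans (solve 3 (λ p q r → (p ⊕ q) ⊕ (p ⊕ r) ⊜ (p ⊕ p) ⊕ (q ⊕ r)) refl (path↔ a x b) (path↔ a b x) (path↔ b a x))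
              (cong (_xor (path↔ a b x xor path↔ b a x)) (BP.xor-same (path↔ a x b)))

    B-sym : ∀ i j k → B i j k ≡ B j i k
    B-sym i j k = cong₂ _xor_ (BP.xor-comm (path↔ i j k) (path↔ j i k))
      (cong₂ _∧_ (Graph.sym G i j) (BP.xor-comm ((i <ᶠ j) ∧ (δ k i ∧ Y i j)) ((j <ᶠ i) ∧ (δ k j ∧ Y j i))))

    B-nonedge : ∀ i j k → adj G i j ≡ false → B i j k ≡ false
    B-nonedge i j k i≁j = cong₂ _xor_
      (cong₂ _xor_ (cong₂ _xor_ (path-nonadjacent₁ i j k i≁j) (path-nonadjacent₂ k j i j≁i))
                   (cong₂ _xor_ (path-nonadjacent₁ j i k j≁i) (path-nonadjacent₂ k i j i≁j)))
      (cong (_∧ (((i <ᶠ j) ∧ (δ k i ∧ Y i j)) xor ((j <ᶠ i) ∧ (δ k j ∧ Y j i)))) i≁j)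
      where j≁i = trans (Graph.sym G j i) i≁j

    correction-off : ∀ {i j k} → k ≢ i → k ≢ j → correction i j k ≡ false
    correction-off {i} {j} {k} k≢i k≢j rewrite δ-≢ k≢i | δ-≢ k≢j =
      trans (cong (adj G i j ∧_) (cong₂ _xor_ (BP.∧-zeroʳ (i <ᶠ j)) (BP.∧-zeroʳ (j <ᶠ i)))) (BP.∧-zeroʳ (adj G i j))

    triple : ∀ {a b c} → a ≢ b → a ≢ c → b ≢ c → B a b c xor (B b c a xor B a c b) ≡ false
    triple {a} {b} {c} a≢b a≢c b≢c
      rewrite correction-off (a≢c ∘ sym) (b≢c ∘ sym) | correction-off a≢b a≢c | correction-off (a≢b ∘ sym) b≢c
            | path↔-reverse c b a | path↔-reverse a c b | path↔-reverse c a b =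
      trans (solve 3 (λ x y z → ((x ⊕ y) ⊕ id) ⊕ (((z ⊕ x) ⊕ id) ⊕ ((z ⊕ y) ⊕ id)) ⊜ (x ⊕ x) ⊕ ((y ⊕ y) ⊕ (z ⊕ z))) refl
                   (path↔ a b c) (path↔ b a c) (path↔ b c a))
            (cong₂ _xor_ (BP.xor-same (path↔ a b c)) (cong₂ _xor_ (BP.xor-same (path↔ b a c)) (BP.xor-same (path↔ b c a))))

    pair : ∀ {a b} → a ≢ b → sum (λ j → B b j a) xor B a b b ≡ false
    pair {a} {b} a≢b = begin
      sum (λ j → B b j a) xor B a b b
        ≡⟨ cong₂ _xor_ (trans (∑-distrib-+ (λ j → B′ b j a) (λ j → correction b j a))
                              (cong (Y a b xor_) (trans (sum-cong-≗ correction-at-a) (∑-δ a _))))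
                       (cong₂ _xor_ (B′-loop a b) correction-loop) ⟩
      (Y a b xor (adj G b a ∧ ((a <ᶠ b) ∧ Y a b))) xor (adj G a b ∧ ((b <ᶠ a) ∧ Y b a))
        ≡⟨ cong (λ t → (Y a b xor (t ∧ ((a <ᶠ b) ∧ Y a b))) xor (adj G a b ∧ ((b <ᶠ a) ∧ Y b a))) (Graph.sym G b a) ⟩
      (Y a b xor (adj G a b ∧ ((a <ᶠ b) ∧ Y a b))) xor (adj G a b ∧ ((b <ᶠ a) ∧ Y b a))
        ≡⟨ by-adjacency (adj G a b) refl ⟩
      false ∎
      where
      open ≡-Reasoning
      correction-at-a : ∀ j → correction b j a ≡ δ j a ∧ (adj G b j ∧ ((j <ᶠ b) ∧ Y j b))
      correction-at-a j rewrite δ-≢ a≢b | BP.∧-zeroʳ (b <ᶠ j) | δ-sym a j = ∧-pull₃ (adj G b j) (j <ᶠ b) (δ j a) (Y j b)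
      correction-loop : correction a b b ≡ adj G a b ∧ ((b <ᶠ a) ∧ Y b a)
      correction-loop rewrite δ-≢ (a≢b ∘ sym) | BP.∧-zeroʳ (a <ᶠ b) | δ-refl b = refl
      by-adjacency : ∀ u → adj G a b ≡ u →
        (Y a b xor (u ∧ ((a <ᶠ b) ∧ Y a b))) xor (u ∧ ((b <ᶠ a) ∧ Y b a)) ≡ false
      by-adjacency false a≁b = trans (BP.xor-identityʳ _) (trans (BP.xor-identityʳ _) (Y-nonedge a b a≁b))
      by-adjacency true a~b = by-order (a <ᶠ b) (b <ᶠ a) refl refl
        where
        by-order : ∀ u v → (a <ᶠ b) ≡ u → (b <ᶠ a) ≡ v → (Y a b xor (u ∧ Y a b)) xor (v ∧ Y b a) ≡ false
        by-order true true a<b b<a = ⊥-elim (BP.not-¬ refl (trans (sym (<ᶠ-asym a b)) (cong₂ _∧_ a<b b<a)))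
        by-order true false _ _ = trans (BP.xor-identityʳ _) (BP.xor-same (Y a b))
        by-order false true _ _ = trans (cong (_xor Y b a) (trans (BP.xor-identityʳ _) (Y-edge-sym a b a~b))) (BP.xor-same (Y b a))
        by-order false false a<b b<a = ⊥-elim (BP.not-¬ (trans (sym (<ᶠ-connex a≢b)) (cong₂ _xor_ a<b b<a)) refl)

    loop-coefficient : ∀ a j → B a j a ≡ adj G a j ∧ ((a <ᶠ j) ∧ Y a j)
    loop-coefficient a j rewrite δ-refl a = trans
      (cong₂ _xor_ (cong₂ _xor_ (BP.xor-same (path a j a))
                                (cong₂ _xor_ (path-nonadjacent₂ j a a (irrefl G a)) (path-nonadjacent₁ a a j (irrefl G a))))
                   (cong (λ t → adj G a j ∧ (((a <ᶠ j) ∧ Y a j) xor t)) below))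
      (cong (adj G a j ∧_) (BP.xor-identityʳ _))
      where
      below : (j <ᶠ a) ∧ (δ a j ∧ Y j a) ≡ false
      below with a Fin.≟ j
      ... | yes refl = cong (_∧ (true ∧ Y a a)) (<ᶠ-irrefl a)
      ... | no _ = BP.∧-zeroʳ (j <ᶠ a)

    ordered-paths : ∀ a j x → adj G a j ∧ ((a <ᶠ j) ∧ path↔ j x a) ≡ path a x j ∧ adj G a j
    ordered-paths a j x = by-order (a <ᶠ j) refl
      where
      by-order : ∀ o → (a <ᶠ j) ≡ o → adj G a j ∧ (o ∧ path↔ j x a) ≡ path a x j ∧ adj G a j
      by-order false a≮j = trans (BP.∧-zeroʳ (adj G a j)) (sym (cong (_∧ adj G a j) (path-unordered a x j a≮j)))
      by-order true a<j = trans (cong (λ t → adj G a j ∧ (t xor path a x j))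
                                      (path-unordered j x a (trans (sym (cong (_∧ (j <ᶠ a)) a<j)) (<ᶠ-asym a j))))
                                (BP.∧-comm (adj G a j) (path a x j))

    middle-edges : ∀ a j x → adj G a j ∧ ((a <ᶠ j) ∧ path↔ x j a) ≡ (a <ᶠ j) ∧ path↔ a j x
    middle-edges a j x rewrite path↔-reverse x j a = absorb (adj G a j) λ h → on-edge (proj₂ (∧-true⇒ h))
      where
      absorb : ∀ x {z} → (z ≡ true → x ≡ true) → x ∧ z ≡ z
      absorb false {false} _ = refl
      absorb false {true} h = h refl
      absorb true _ = refl
      on-edge : path↔ a j x ≡ true → adj G a j ≡ true
      on-edge h with path a j x in p
      ... | true = proj₁ (proj₂ (path-spec p))
      ... | false = trans (Graph.sym G a j) (proj₂ (proj₂ (path-spec h)))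

    total : sum (λ a → sum λ j → B a j a) ≡ true
    total = begin
      sum (λ a → sum λ j → B a j a)
        ≡⟨ sum-cong-≗ (λ a → sum-cong-≗ λ j → trans (loop-coefficient a j)
             (trans (cong (adj G a j ∧_) (*-distribˡ-sum (a <ᶠ j) (λ x → B′ j x a)))
                    (*-distribˡ-sum (adj G a j) (λ x → (a <ᶠ j) ∧ B′ j x a)))) ⟩
      sum³ (λ a j x → adj G a j ∧ ((a <ᶠ j) ∧ (path↔ j x a xor path↔ x j a)))
        ≡⟨ sum³-cong (λ a j x → trans (cong (adj G a j ∧_) (BP.∧-distribˡ-xor (a <ᶠ j) _ _)) (BP.∧-distribˡ-xor (adj G a j) _ _)) ⟩
      sum³ (λ a j x → (adj G a j ∧ ((a <ᶠ j) ∧ path↔ j x a)) xor (adj G a j ∧ ((a <ᶠ j) ∧ path↔ x j a)))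
        ≡⟨ sum³-xor (λ a j x → adj G a j ∧ ((a <ᶠ j) ∧ path↔ j x a)) (λ a j x → adj G a j ∧ ((a <ᶠ j) ∧ path↔ x j a)) ⟩
      sum³ (λ a j x → adj G a j ∧ ((a <ᶠ j) ∧ path↔ j x a)) xor sum³ (λ a j x → adj G a j ∧ ((a <ᶠ j) ∧ path↔ x j a))
        ≡⟨ cong₂ _xor_ (trans (sum³-cong ordered-paths) (sum³-swap₂₃ (λ i j k → path i j k ∧ adj G i k)))
                       (trans (sum³-cong middle-edges) middle-paths) ⟩
      sum³ (λ i j k → path i j k ∧ adj G i k) xor sum³ (λ i j k → path i j k ∧ ((i <ᶠ j) ∧ (j <ᶠ k)))
        ≡⟨ cong (_xor sum³ (λ i j k → path i j k ∧ ((i <ᶠ j) ∧ (j <ᶠ k)))) (paths-in-triangles paths-between-nonadjacent) ⟨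
      sum³ path xor sum³ (λ i j k → path i j k ∧ ((i <ᶠ j) ∧ (j <ᶠ k)))
        ≡⟨ extremal-split ⟨
      sum³ (λ i j k → path i j k ∧ extremal i j k)
        ≡⟨ condition₂ ⟩
      true ∎
      where open ≡-Reasoning

  reduced : ReducedCertificate G
  reduced = record
    { B = B ; B-sym = B-sym ; B-nonedge = B-nonedge ; total = total ; pair = pair ; triple = triple }

reduced-of-covered : (G : Graph) → CoveredByLength2Paths G → ReducedCertificate G
reduced-of-covered G (C , c₁ , c₂ , c₃) = CertificateOfCover.reduced G C
  (λ a b a~b → trans (sym (condition₁-sum a b))
                     (sum³-via-parity (λ i j k → path i j k ∧ (sameEdge i j a b xor sameEdge j k a b)) (c₁ a b a~b)))
  (sum³-via-parity (λ i j k → path i j k ∧ extremal i j k) c₂)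
  (λ a b a≁b → trans (sym (condition₃-sum a b)) (sum³-via-parity (λ i j k → path i j k ∧ sameEdge i k a b) (c₃ a b a≁b)))
  where open Paths G C

theorem1p6 : (G : Graph) → N≡ G 1 ⇔ CoveredByLength2Paths G
theorem1p6 G = mk⇔ (CoverOfCertificate.covered G ∘ to) (from ∘ reduced-of-covered G)
  where open Equivalence (N≡1⇔reduced G)
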